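{- For all integers $k,r$ with $r\geq0$, the family of binomial coefficients $\binom{kp}{rp}$ (indexed by primes $p$) is asymptotically representable.
   Context: A composition is a finite ordered tuple $\mathbf{s}=(s_1,\ldots,s_k)$ of positive integers (empty allowed), weight $w(\mathbf{s})=\sum s_i$; $H_n(\mathbf{s})=\sum_{n\geq n_1>\cdots>n_k\geq1}n_1^{ -s_1}\cdots n_k^{ -s_k}$, $H_n(\varnothing)=1$. A collection $a_p\in\mathbb{Z}_p$ (defined for all but finitely many primes $p$) is asymptotically representable if there are coefficients $\alpha_{\mathbf{s}}\in\mathbb{Q}$, one for each composition and independent of $p$, such that for every $n\geq1$ the congruence $a_p\equiv\sum_{w(\mathbf{s})<n}\alpha_{\mathbf{s}}p^{w(\mathbf{s})}H_{p-1}(\mathbf{s})\pmod{p^n}$ holds for all sufficiently large $p$. -}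

module Defs where

open import Data.Nat as ℕ using (ℕ; zero; suc; _^_; _∸_)
open import Data.Nat.Properties using (m^n≢0)
open import Data.Nat.Divisibility using (_∣_)
open import Data.Integer as ℤ using (ℤ; +_)
open import Data.Rational using (ℚ; _/_; _+_; _*_; _-_; 0ℚ; 1ℚ; ↥_)
open import Data.Product using (∃-syntax)
open import Data.Nat.Primality using (Prime)
open import Data.List using (List; []; _∷_; map; _++_; concatMap; upTo; foldr)

-- A composition (s₁,…,sₖ) is represented as a list of natural numbers
-- whose entries are all positive; the enumeration below only produces such lists.
Composition : Set
Composition = List ℕ

weight : Composition → ℕ
weight = foldr ℕ._+_ 0

-- all compositions of weight exactly w (each listed exactly once):
-- a composition of w+1 either starts with a part 1 followed by a composition of w,
-- or arises from a nonempty composition of w by increasing its first part.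
private
  incHead : Composition → List Composition
  incHead []       = []
  incHead (x ∷ xs) = (suc x ∷ xs) ∷ []

compositionsOf : ℕ → List Composition
compositionsOf zero    = [] ∷ []
compositionsOf (suc w) = map (1 ∷_) (compositionsOf w) ++ concatMap incHead (compositionsOf w)

compositionsBelow : ℕ → List Composition
compositionsBelow n = concatMap compositionsOf (upTo n)

sumℚ : List ℚ → ℚ
sumℚ = foldr _+_ 0ℚ

invPow : (j s : ℕ) → ℚ
invPow j s = (+ 1) / (suc j ^ s)
  where instance _ = m^n≢0 (suc j) s

-- multiple harmonic sum H_n(s) = Σ_{n ≥ n₁ > … > nₖ ≥ 1} n₁^{-s₁} ⋯ nₖ^{-sₖ},  H_n(∅) = 1.
-- Recursively: H_n(s₁,s') = Σ_{m=1}^{n} m^{-s₁} H_{m-1}(s').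
H : ℕ → Composition → ℚ
H n []       = 1ℚ
H n (s ∷ ss) = sumℚ (map (λ j → invPow j s * H j ss) (upTo n))
  -- j ranges over 0..n-1, m = j+1, and H_{m-1} = H_j

binom : ℤ → ℕ → ℚ
binom x zero    = 1ℚ
binom x (suc m) = binom x m * ((x ℤ.- + m) / suc m)

-- congruence in ℤ_p of rationals: x ≡ y (mod pⁿ) iff pⁿ divides the
-- (normalized) numerator of x - y   (for n ≥ 1 this forces x - y ∈ ℤ_(p))
_≡_[mod_^_] : ℚ → ℚ → ℕ → ℕ → Set
x ≡ y [mod p ^ n ] = (p ^ n) ∣ ℤ.∣ ↥ (x - y) ∣

ℕtoℚ : ℕ → ℚ
ℕtoℚ m = (+ m) / 1

truncatedSum : (Composition → ℚ) → ℕ → ℕ → ℚ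
truncatedSum α n p =
  sumℚ (map (λ s → α s * ℕtoℚ (p ^ weight s) * H (p ∸ 1) s) (compositionsBelow n))

AsymptoticallyRepresentable : (ℕ → ℚ) → Set
AsymptoticallyRepresentable a =
  ∃[ α ] ((n : ℕ) → 1 ℕ.≤ n → ∃[ P ] ((p : ℕ) → Prime p → P ℕ.≤ p →
      a p ≡ truncatedSum α n p [mod p ^ n ]))

{-# OPTIONS --safe #-}
-- For an odd prime p and Q_l(p) = ∏_{t=1}^{p-1} (1 + lp/t), grouping the factors of binom(kp, rp)
-- into blocks of p consecutive integers gives
--   binom(kp, rp) · ∏_{m<r} Q_m(p) = binom(k, r) · ∏_{m<r} Q_{m-k}(p).
-- Expanding the product, Q_l(p) = Σ_j (lp)^j H_{p-1}(1,…,1) is representable. Representable families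
-- are closed under products, because the stuffle product H(s)·H(t) = Σ H(s ∗ t) preserves weights and
-- the p-integrality of the coefficients, and under division by families ≡ 1 mod p, which are p-adic
-- units. Dividing by ∏_{m<r} Q_m(p) proves the theorem.
module Submission where

open import Defs
open import Algebra.Bundles using (CommutativeRing)
import Algebra.Properties.CommutativeSemiring.Exp as Exp
open import Data.Bool using (if_then_else_)
open import Data.Empty using (⊥-elim)
open import Data.Integer as ℤ using (ℤ; +_)
import Data.Integer.Divisibility.Signed as ℤ∣
import Data.Integer.Properties as ℤP
open import Data.List using (List; []; _∷_; [_]; map; _++_; concatMap; upTo; length; replicate)
import Data.List.Properties as ListP
open import Data.List.Relation.Unary.All as All using (All; []; _∷_)
import Data.List.Relation.Unary.All.Properties as AllP
open import Data.Nat as ℕ using (ℕ; zero; suc; _∸_; z≤n; s≤s)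
open import Data.Nat.Divisibility as ℕ∣ using (_∣_; divides)
import Data.Nat.DivMod as ℕ/
open import Data.Nat.Tactic.RingSolver using (solve-∀)
open import Data.Nat.Primality using (Prime; euclidsLemma; prime⇒nonZero; prime⇒irreducible; ¬prime[0]; ¬prime[1])
import Data.Nat.Properties as ℕP
open import Data.Product using (Σ; _×_; _,_; proj₁; proj₂; ∃-syntax)
open import Data.Rational using (ℚ; _/_; _+_; _*_; _-_; -_; 0ℚ; 1ℚ; ↥_; ↧ₙ_; toℚᵘ)
import Data.Rational.Properties as ℚP
open import Data.Rational.Solver using (module +-*-Solver)
import Data.Rational.Unnormalised as ℚᵘ
import Data.Rational.Unnormalised.Properties as ℚᵘP
open import Data.Sum using (inj₁; inj₂)
open import Function using (_∘_)
open import Relation.Binary.PropositionalEquality hiding ([_])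
open import Relation.Nullary using (¬_)

open Exp (CommutativeRing.commutativeSemiring ℚP.+-*-commutativeRing) using (_^_; ^-distrib-*)
open +-*-Solver using (solve; _:+_; _:*_; _:-_; :-_; _:=_; con)
open ≡-Reasoning

-- Opaque, so that ι i is never normalised through the gcd computation hidden in _/_.
opaque
  ι : ℤ → ℚ
  ι i = i / 1

  ι≃mkℚᵘ : ∀ i → toℚᵘ (ι i) ℚᵘ.≃ ℚᵘ.mkℚᵘ i 0
  ι≃mkℚᵘ i = ℚP.toℚᵘ-fromℚᵘ (ℚᵘ.mkℚᵘ i 0)

  ι-+ : ∀ i j → ι (i ℤ.+ j) ≡ ι i + ι j
  ι-+ i j = ℚP.toℚᵘ-injective (ℚᵘP.≃-trans (ι≃mkℚᵘ (i ℤ.+ j))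
    (ℚᵘP.≃-trans (ℚᵘ.*≡* lemma) (ℚᵘP.≃-sym (ℚᵘP.≃-trans (ℚP.toℚᵘ-homo-+ (ι i) (ι j)) (ℚᵘP.+-cong (ι≃mkℚᵘ i) (ι≃mkℚᵘ j))))))
    where
    lemma : (i ℤ.+ j) ℤ.* + 1 ≡ (i ℤ.* + 1 ℤ.+ j ℤ.* + 1) ℤ.* + 1
    lemma = cong (ℤ._* + 1) (sym (cong₂ ℤ._+_ (ℤP.*-identityʳ i) (ℤP.*-identityʳ j)))

  ι-* : ∀ i j → ι (i ℤ.* j) ≡ ι i * ι j
  ι-* i j = ℚP.toℚᵘ-injective (ℚᵘP.≃-trans (ι≃mkℚᵘ (i ℤ.* j))
    (ℚᵘP.≃-trans (ℚᵘ.*≡* refl) (ℚᵘP.≃-sym (ℚᵘP.≃-trans (ℚP.toℚᵘ-homo-* (ι i) (ι j)) (ℚᵘP.*-cong (ι≃mkℚᵘ i) (ι≃mkℚᵘ j))))))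

  ι-neg : ∀ i → ι (ℤ.- i) ≡ - ι i
  ι-neg i = ℚP.toℚᵘ-injective (ℚᵘP.≃-trans (ι≃mkℚᵘ (ℤ.- i))
    (ℚᵘP.≃-trans (ℚᵘ.*≡* refl) (ℚᵘP.≃-sym (ℚᵘP.≃-trans (ℚP.toℚᵘ-homo‿- (ι i)) (ℚᵘP.-‿cong (ι≃mkℚᵘ i))))))

  /-*-ι : ∀ i n .{{_ : ℕ.NonZero n}} → (i / n) * ι (+ n) ≡ ι i
  /-*-ι i (suc n) = ℚP.toℚᵘ-injective (ℚᵘP.≃-trans (ℚP.toℚᵘ-homo-* (i / suc n) (ι (+ suc n)))
    (ℚᵘP.≃-trans (ℚᵘP.*-cong (ℚP.toℚᵘ-fromℚᵘ (ℚᵘ.mkℚᵘ i n)) (ι≃mkℚᵘ (+ suc n))) (ℚᵘP.≃-trans (ℚᵘ.*≡* lemma) (ℚᵘP.≃-sym (ι≃mkℚᵘ i)))))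
    where
    lemma : (i ℤ.* + suc n) ℤ.* + 1 ≡ i ℤ.* + (suc n ℕ.* 1)
    lemma = trans (ℤP.*-identityʳ _) (cong (λ m → i ℤ.* + m) (sym (ℕP.*-identityʳ (suc n))))

  ℕtoℚ≡ι : ∀ m → ℕtoℚ m ≡ ι (+ m)
  ℕtoℚ≡ι m = refl

  ι-0 : ι (+ 0) ≡ 0ℚ
  ι-0 = refl

  ι-1 : ι (+ 1) ≡ 1ℚ
  ι-1 = refl

ι-injective : ∀ {i j} → ι i ≡ ι j → i ≡ j
ι-injective {i} {j} eq with ℚᵘP.≃-trans (ℚᵘP.≃-sym (ι≃mkℚᵘ i)) (ℚᵘP.≃-trans (ℚᵘP.≃-reflexive (cong toℚᵘ eq)) (ι≃mkℚᵘ j))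
... | ℚᵘ.*≡* eq′ = trans (sym (ℤP.*-identityʳ i)) (trans eq′ (ℤP.*-identityʳ j))

ι-- : ∀ i j → ι (i ℤ.- j) ≡ ι i - ι j
ι-- i j = trans (ι-+ i (ℤ.- j)) (cong (λ z → ι i + z) (ι-neg j))

ιℕ-+ : ∀ a b → ι (+ (a ℕ.+ b)) ≡ ι (+ a) + ι (+ b)
ιℕ-+ a b = trans (cong ι (ℤP.pos-+ a b)) (ι-+ (+ a) (+ b))

ιℕ-* : ∀ a b → ι (+ (a ℕ.* b)) ≡ ι (+ a) * ι (+ b)
ιℕ-* a b = trans (cong ι (ℤP.pos-* a b)) (ι-* (+ a) (+ b))

↥/↧-*-ι : ∀ c → c * ι (+ ↧ₙ c) ≡ ι (↥ c)
↥/↧-*-ι c = trans (cong (_* ι (+ ↧ₙ c)) (sym (ℚP.↥p/↧p≡p c))) (/-*-ι (↥ c) (↧ₙ c))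

*-ι-cancelʳ : ∀ m .{{_ : ℕ.NonZero m}} x y → x * ι (+ m) ≡ y * ι (+ m) → x ≡ y
*-ι-cancelʳ m x y eq = begin
  x                        ≡⟨ sym (ℚP.*-identityʳ x) ⟩
  x * 1ℚ                   ≡⟨ cong (x *_) (sym m*m⁻¹) ⟩
  x * (ι (+ m) * m⁻¹)      ≡⟨ sym (ℚP.*-assoc x _ m⁻¹) ⟩
  (x * ι (+ m)) * m⁻¹      ≡⟨ cong (_* m⁻¹) eq ⟩
  (y * ι (+ m)) * m⁻¹      ≡⟨ ℚP.*-assoc y _ m⁻¹ ⟩
  y * (ι (+ m) * m⁻¹)      ≡⟨ cong (y *_) m*m⁻¹ ⟩
  y * 1ℚ                   ≡⟨ ℚP.*-identityʳ y ⟩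
  y                        ∎
  where
  m⁻¹ = (+ 1) / m
  m*m⁻¹ : ι (+ m) * m⁻¹ ≡ 1ℚ
  m*m⁻¹ = trans (ℚP.*-comm (ι (+ m)) m⁻¹) (trans (/-*-ι (+ 1) m) ι-1)

pow : ℕ → ℕ → ℚ
pow p n = ι (+ (p ℕ.^ n))

pow-+ : ∀ p m n → pow p (m ℕ.+ n) ≡ pow p m * pow p n
pow-+ p m n = trans (cong (λ x → ι (+ x)) (ℕP.^-distribˡ-+-* p m n)) (ιℕ-* (p ℕ.^ m) (p ℕ.^ n))

invPow-*-pow : ∀ j s → invPow j s * pow (suc j) s ≡ 1ℚ
invPow-*-pow j s = trans (/-*-ι (+ 1) (suc j ℕ.^ s) {{ℕP.m^n≢0 (suc j) s}}) ι-1

invPow-+ : ∀ j a b → invPow j (a ℕ.+ b) ≡ invPow j a * invPow j b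
invPow-+ j a b = *-ι-cancelʳ (suc j ℕ.^ (a ℕ.+ b)) {{ℕP.m^n≢0 (suc j) (a ℕ.+ b)}} _ _ (begin
  invPow j (a ℕ.+ b) * pow (suc j) (a ℕ.+ b)  ≡⟨ invPow-*-pow j (a ℕ.+ b) ⟩
  1ℚ                                         ≡⟨ sym (trans (cong₂ _*_ (invPow-*-pow j a) (invPow-*-pow j b)) (ℚP.*-identityˡ 1ℚ)) ⟩
  (u * A) * (v * B)                          ≡⟨ solve 4 (λ u A v B → (u :* A) :* (v :* B) := (u :* v) :* (A :* B)) refl u A v B ⟩
  (u * v) * (A * B)                          ≡⟨ cong ((u * v) *_) (sym (pow-+ (suc j) a b)) ⟩
  (u * v) * pow (suc j) (a ℕ.+ b)            ∎)
  where
  u = invPow j a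
  v = invPow j b
  A = pow (suc j) a
  B = pow (suc j) b

-- Divisibility by prime powers in the local ring ℤ₍ₚ₎

record Div[_^_] (p n : ℕ) (x : ℚ) : Set where
  constructor mkDiv
  field
    num          : ℤ
    den          : ℤ
    p∤den        : ¬ (p ∣ ℤ.∣ den ∣)
    *den≡pow*num : x * ι den ≡ pow p n * ι num

div-cong : ∀ {p n x y} → x ≡ y → Div[ p ^ n ] x → Div[ p ^ n ] y
div-cong refl d = d

div-weaken : ∀ {p m n x} → m ℕ.≤ n → Div[ p ^ n ] x → Div[ p ^ m ] x
div-weaken {p} {m} {n} {x} m≤n (mkDiv a b p∤b eq) = mkDiv (+ (p ℕ.^ (n ∸ m)) ℤ.* a) b p∤b (begin
  x * ι b                              ≡⟨ eq ⟩
  pow p n * ι a                        ≡⟨ cong (λ k → pow p k * ι a) (sym (ℕP.m+[n∸m]≡n m≤n)) ⟩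
  pow p (m ℕ.+ (n ∸ m)) * ι a          ≡⟨ cong (_* ι a) (pow-+ p m (n ∸ m)) ⟩
  (pow p m * pow p (n ∸ m)) * ι a      ≡⟨ ℚP.*-assoc (pow p m) _ (ι a) ⟩
  pow p m * (pow p (n ∸ m) * ι a)      ≡⟨ cong (pow p m *_) (sym (ι-* _ a)) ⟩
  pow p m * ι (+ (p ℕ.^ (n ∸ m)) ℤ.* a) ∎)

module _ {p : ℕ} (p-prime : Prime p) where

  p∤1 : ¬ (p ∣ 1)
  p∤1 p∣1 = ¬prime[1] (subst Prime (ℕ∣.∣1⇒≡1 p∣1) p-prime)

  p∤*  : ∀ {b c} → ¬ (p ∣ ℤ.∣ b ∣) → ¬ (p ∣ ℤ.∣ c ∣) → ¬ (p ∣ ℤ.∣ b ℤ.* c ∣)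
  p∤* {b} {c} p∤b p∤c p∣bc with euclidsLemma ℤ.∣ b ∣ ℤ.∣ c ∣ p-prime (subst (p ∣_) (ℤP.abs-* b c) p∣bc)
  ... | inj₁ p∣b = p∤b p∣b
  ... | inj₂ p∣c = p∤c p∣c

  p∣^⇒p∣ : ∀ m s → p ∣ m ℕ.^ s → p ∣ m
  p∣^⇒p∣ m zero    p∣1 = ⊥-elim (p∤1 p∣1)
  p∣^⇒p∣ m (suc s) p∣m^s+1 with euclidsLemma m (m ℕ.^ s) p-prime p∣m^s+1
  ... | inj₁ p∣m   = p∣m
  ... | inj₂ p∣m^s = p∣^⇒p∣ m s p∣m^s

  p^n∣m*c⇒p^n∣m : ∀ n m c → ¬ (p ∣ c) → p ℕ.^ n ∣ m ℕ.* c → p ℕ.^ n ∣ m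
  p^n∣m*c⇒p^n∣m zero    m c p∤c _ = ℕ∣.1∣ m
  p^n∣m*c⇒p^n∣m (suc n) m c p∤c p^n+1∣mc with euclidsLemma m c p-prime (ℕ∣.∣-trans (ℕ∣.m∣m*n (p ℕ.^ n)) p^n+1∣mc)
  ... | inj₂ p∣c = ⊥-elim (p∤c p∣c)
  ... | inj₁ (divides q refl) =
    subst (_∣ q ℕ.* p) (ℕP.*-comm (p ℕ.^ n) p) (ℕ∣.*-monoˡ-∣ p (p^n∣m*c⇒p^n∣m n q c p∤c p^n∣qc))
    where
    instance _ = prime⇒nonZero p-prime
    p^n∣qc : p ℕ.^ n ∣ q ℕ.* c
    p^n∣qc = ℕ∣.*-cancelˡ-∣ p (subst (p ℕ.* p ℕ.^ n ∣_) (trans (cong (ℕ._* c) (ℕP.*-comm q p)) (ℕP.*-assoc p q c)) p^n+1∣mc)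

  div-0 : ∀ {n} → Div[ p ^ n ] 0ℚ
  div-0 {n} = mkDiv (+ 0) (+ 1) p∤1 (trans (ℚP.*-zeroˡ (ι (+ 1))) (sym (trans (cong (pow p n *_) ι-0) (ℚP.*-zeroʳ (pow p n)))))

  div-ι : ∀ i → Div[ p ^ 0 ] (ι i)
  div-ι i = mkDiv i (+ 1) p∤1 (trans (cong (ι i *_) ι-1) (trans (ℚP.*-identityʳ (ι i)) (sym (trans (cong (_* ι i) ι-1) (ℚP.*-identityˡ (ι i))))))

  div-pow : ∀ n → Div[ p ^ n ] (pow p n)
  div-pow n = mkDiv (+ 1) (+ 1) p∤1 refl

  div-den<p : ∀ c → ↧ₙ c ℕ.< p → Div[ p ^ 0 ] c
  div-den<p c ↧c<p = mkDiv (↥ c) (+ ↧ₙ c) (λ p∣↧c → ℕP.<⇒≱ ↧c<p (ℕ∣.∣⇒≤ p∣↧c))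
    (trans (↥/↧-*-ι c) (sym (trans (cong (_* ι (↥ c)) ι-1) (ℚP.*-identityˡ (ι (↥ c))))))

  div-invPow : ∀ j s → suc j ℕ.< p → Div[ p ^ 0 ] (invPow j s)
  div-invPow j s j+1<p = mkDiv (+ 1) (+ (suc j ℕ.^ s)) p∤den
    (trans (invPow-*-pow j s) (sym (trans (cong₂ _*_ ι-1 ι-1) (ℚP.*-identityˡ 1ℚ))))
    where
    p∤den : ¬ (p ∣ suc j ℕ.^ s)
    p∤den p∣den = ℕP.<⇒≱ j+1<p (ℕ∣.∣⇒≤ (p∣^⇒p∣ (suc j) s p∣den))

  div-+ : ∀ {n x y} → Div[ p ^ n ] x → Div[ p ^ n ] y → Div[ p ^ n ] (x + y)
  div-+ {n} {x} {y} (mkDiv a b p∤b e) (mkDiv a′ b′ p∤b′ e′) =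
    mkDiv (a ℤ.* b′ ℤ.+ a′ ℤ.* b) (b ℤ.* b′) (p∤* {b} {b′} p∤b p∤b′) (begin
      (x + y) * ι (b ℤ.* b′)                        ≡⟨ cong ((x + y) *_) (ι-* b b′) ⟩
      (x + y) * (ι b * ι b′)                        ≡⟨ solve 4 (λ x y u v → (x :+ y) :* (u :* v) := (x :* u) :* v :+ (y :* v) :* u) refl x y (ι b) (ι b′) ⟩
      (x * ι b) * ι b′ + (y * ι b′) * ι b           ≡⟨ cong₂ (λ s t → s * ι b′ + t * ι b) e e′ ⟩
      (P * ι a) * ι b′ + (P * ι a′) * ι b           ≡⟨ solve 5 (λ P a b′ a′ b → (P :* a) :* b′ :+ (P :* a′) :* b := P :* (a :* b′ :+ a′ :* b)) refl P (ι a) (ι b′) (ι a′) (ι b) ⟩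
      P * (ι a * ι b′ + ι a′ * ι b)                 ≡⟨ cong (P *_) (sym (trans (ι-+ _ _) (cong₂ _+_ (ι-* a b′) (ι-* a′ b)))) ⟩
      P * ι (a ℤ.* b′ ℤ.+ a′ ℤ.* b)                 ∎)
    where P = pow p n

  div-neg : ∀ {n x} → Div[ p ^ n ] x → Div[ p ^ n ] (- x)
  div-neg {n} {x} (mkDiv a b p∤b e) = mkDiv (ℤ.- a) b p∤b (begin
    (- x) * ι b           ≡⟨ sym (ℚP.neg-distribˡ-* x (ι b)) ⟩
    - (x * ι b)           ≡⟨ cong -_ e ⟩
    - (pow p n * ι a)     ≡⟨ ℚP.neg-distribʳ-* (pow p n) (ι a) ⟩
    pow p n * (- ι a)     ≡⟨ cong (pow p n *_) (sym (ι-neg a)) ⟩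
    pow p n * ι (ℤ.- a)   ∎)

  div-* : ∀ {m n x y} → Div[ p ^ m ] x → Div[ p ^ n ] y → Div[ p ^ (m ℕ.+ n) ] (x * y)
  div-* {m} {n} {x} {y} (mkDiv a b p∤b e) (mkDiv a′ b′ p∤b′ e′) =
    mkDiv (a ℤ.* a′) (b ℤ.* b′) (p∤* {b} {b′} p∤b p∤b′) (begin
      (x * y) * ι (b ℤ.* b′)                  ≡⟨ cong ((x * y) *_) (ι-* b b′) ⟩
      (x * y) * (ι b * ι b′)                  ≡⟨ solve 4 (λ x y u v → (x :* y) :* (u :* v) := (x :* u) :* (y :* v)) refl x y (ι b) (ι b′) ⟩
      (x * ι b) * (y * ι b′)                  ≡⟨ cong₂ _*_ e e′ ⟩
      (pow p m * ι a) * (pow p n * ι a′)      ≡⟨ solve 4 (λ P a Q a′ → (P :* a) :* (Q :* a′) := (P :* Q) :* (a :* a′)) refl (pow p m) (ι a) (pow p n) (ι a′) ⟩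
      (pow p m * pow p n) * (ι a * ι a′)      ≡⟨ sym (cong₂ _*_ (pow-+ p m n) (ι-* a a′)) ⟩
      pow p (m ℕ.+ n) * ι (a ℤ.* a′)          ∎)

  div-*ˡ : ∀ {n x y} → Div[ p ^ 0 ] x → Div[ p ^ n ] y → Div[ p ^ n ] (x * y)
  div-*ˡ = div-*

  div-*ʳ : ∀ {n x y} → Div[ p ^ n ] x → Div[ p ^ 0 ] y → Div[ p ^ n ] (x * y)
  div-*ʳ {n} {x} {y} dx dy = subst (λ k → Div[ p ^ k ] (x * y)) (ℕP.+-identityʳ n) (div-* dx dy)

  div-pow-* : ∀ {x} n → Div[ p ^ 0 ] x → Div[ p ^ n ] (pow p n * x)
  div-pow-* n = div-*ʳ (div-pow n)

  -- If 1 - d ∈ pℤ₍ₚ₎ then d is a unit of ℤ₍ₚ₎, so a·d ∈ ℤ₍ₚ₎ forces a ∈ ℤ₍ₚ₎.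
  div-*-unit : ∀ {a c d} → Div[ p ^ 0 ] c → Div[ p ^ 1 ] (d - 1ℚ) → a * d ≡ c → Div[ p ^ 0 ] a
  div-*-unit {a} {c} {d} (mkDiv c′ b′ p∤b′ e′) (mkDiv s b p∤b e) ad≡c =
    mkDiv (c′ ℤ.* b) (u ℤ.* b′) (p∤* {u} {b′} p∤u p∤b′) (begin
      a * ι (u ℤ.* b′)        ≡⟨ cong (a *_) (ι-* u b′) ⟩
      a * (ι u * ι b′)        ≡⟨ cong (λ z → a * (z * ι b′)) (sym d*b≡u) ⟩
      a * ((d * ι b) * ι b′)  ≡⟨ solve 4 (λ a d b b′ → a :* ((d :* b) :* b′) := ((a :* d) :* b′) :* b) refl a d (ι b) (ι b′) ⟩
      ((a * d) * ι b′) * ι b  ≡⟨ cong (λ z → (z * ι b′) * ι b) ad≡c ⟩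
      (c * ι b′) * ι b        ≡⟨ cong (_* ι b) (trans e′ (trans (cong (_* ι c′) ι-1) (ℚP.*-identityˡ (ι c′)))) ⟩
      ι c′ * ι b              ≡⟨ sym (ι-* c′ b) ⟩
      ι (c′ ℤ.* b)            ≡⟨ sym (trans (cong (_* ι (c′ ℤ.* b)) ι-1) (ℚP.*-identityˡ (ι (c′ ℤ.* b)))) ⟩
      pow p 0 * ι (c′ ℤ.* b)  ∎)
    where
    u = b ℤ.+ + (p ℕ.^ 1) ℤ.* s
    p∤u : ¬ (p ∣ ℤ.∣ u ∣)
    p∤u p∣u = p∤b (ℤ∣.∣⇒∣ᵤ (ℤ∣.∣m+n∣n⇒∣m {+ p} {b} (ℤ∣.∣ᵤ⇒∣ p∣u)
      (ℤ∣.∣m⇒∣m*n s (ℤ∣.∣ᵤ⇒∣ {+ p} {+ (p ℕ.^ 1)} (ℕ∣.∣-reflexive (sym (ℕP.*-identityʳ p)))))))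
    d*b≡u : d * ι b ≡ ι u
    d*b≡u = begin
      d * ι b                    ≡⟨ solve 2 (λ d b → d :* b := (d :- con 1ℚ) :* b :+ b) refl d (ι b) ⟩
      (d - 1ℚ) * ι b + ι b       ≡⟨ cong (_+ ι b) e ⟩
      pow p 1 * ι s + ι b        ≡⟨ ℚP.+-comm (pow p 1 * ι s) (ι b) ⟩
      ι b + pow p 1 * ι s        ≡⟨ sym (trans (ι-+ b _) (cong (λ z → ι b + z) (ι-* (+ (p ℕ.^ 1)) s))) ⟩
      ι u                        ∎

  div⇒∣numerator : ∀ {n z} → Div[ p ^ n ] z → p ℕ.^ n ∣ ℤ.∣ ↥ z ∣
  div⇒∣numerator {n} {z} (mkDiv a b p∤b e) =
    p^n∣m*c⇒p^n∣m n ℤ.∣ ↥ z ∣ ℤ.∣ b ∣ p∤b (divides ℤ.∣ a ℤ.* + d ∣ ∣↥z∣*∣b∣≡)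
    where
    d = ↧ₙ z
    ↥z*b≡ : ι (↥ z ℤ.* b) ≡ ι (+ (p ℕ.^ n) ℤ.* (a ℤ.* + d))
    ↥z*b≡ = begin
      ι (↥ z ℤ.* b)                      ≡⟨ ι-* (↥ z) b ⟩
      ι (↥ z) * ι b                      ≡⟨ cong (_* ι b) (sym (↥/↧-*-ι z)) ⟩
      (z * ι (+ d)) * ι b                ≡⟨ solve 3 (λ z d b → (z :* d) :* b := (z :* b) :* d) refl z (ι (+ d)) (ι b) ⟩
      (z * ι b) * ι (+ d)                ≡⟨ cong (_* ι (+ d)) e ⟩
      (pow p n * ι a) * ι (+ d)          ≡⟨ ℚP.*-assoc (pow p n) (ι a) (ι (+ d)) ⟩
      pow p n * (ι a * ι (+ d))          ≡⟨ sym (trans (ι-* (+ (p ℕ.^ n)) (a ℤ.* + d)) (cong (pow p n *_) (ι-* a (+ d)))) ⟩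
      ι (+ (p ℕ.^ n) ℤ.* (a ℤ.* + d))    ∎
    ∣↥z∣*∣b∣≡ : ℤ.∣ ↥ z ∣ ℕ.* ℤ.∣ b ∣ ≡ ℤ.∣ a ℤ.* + d ∣ ℕ.* p ℕ.^ n
    ∣↥z∣*∣b∣≡ = trans (sym (ℤP.abs-* (↥ z) b)) (trans (cong ℤ.∣_∣ (ι-injective ↥z*b≡))
      (trans (ℤP.abs-* (+ (p ℕ.^ n)) (a ℤ.* + d)) (ℕP.*-comm (p ℕ.^ n) _)))

sumTo : ℕ → (ℕ → ℚ) → ℚ
sumTo zero    f = 0ℚ
sumTo (suc n) f = sumTo n f + f n

prodTo : ℕ → (ℕ → ℚ) → ℚ
prodTo zero    f = 1ℚ
prodTo (suc n) f = prodTo n f * f n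

sumTo-cong : ∀ n {f g} → (∀ i → i ℕ.< n → f i ≡ g i) → sumTo n f ≡ sumTo n g
sumTo-cong zero    f≡g = refl
sumTo-cong (suc n) f≡g = cong₂ _+_ (sumTo-cong n (λ i i<n → f≡g i (ℕP.m<n⇒m<1+n i<n))) (f≡g n (ℕP.n<1+n n))

sumTo-unfoldˡ : ∀ n f → sumTo (suc n) f ≡ f 0 + sumTo n (f ∘ suc)
sumTo-unfoldˡ zero    f = trans (ℚP.+-identityˡ (f 0)) (sym (ℚP.+-identityʳ (f 0)))
sumTo-unfoldˡ (suc n) f = begin
  sumTo (suc n) f + f (suc n)            ≡⟨ cong (_+ f (suc n)) (sumTo-unfoldˡ n f) ⟩
  (f 0 + sumTo n (f ∘ suc)) + f (suc n)  ≡⟨ ℚP.+-assoc (f 0) _ _ ⟩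
  f 0 + sumTo (suc n) (f ∘ suc)          ∎

sumTo-++ : ∀ m n f → sumTo (m ℕ.+ n) f ≡ sumTo m f + sumTo n (λ i → f (m ℕ.+ i))
sumTo-++ m zero    f = trans (cong (λ k → sumTo k f) (ℕP.+-identityʳ m)) (sym (ℚP.+-identityʳ _))
sumTo-++ m (suc n) f = begin
  sumTo (m ℕ.+ suc n) f                                      ≡⟨ cong (λ k → sumTo k f) (ℕP.+-suc m n) ⟩
  sumTo (m ℕ.+ n) f + f (m ℕ.+ n)                            ≡⟨ cong (_+ f (m ℕ.+ n)) (sumTo-++ m n f) ⟩
  (sumTo m f + sumTo n (λ i → f (m ℕ.+ i))) + f (m ℕ.+ n)    ≡⟨ ℚP.+-assoc (sumTo m f) _ (f (m ℕ.+ n)) ⟩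
  sumTo m f + sumTo (suc n) (λ i → f (m ℕ.+ i))              ∎

sumTo-0 : ∀ n → sumTo n (λ _ → 0ℚ) ≡ 0ℚ
sumTo-0 zero    = refl
sumTo-0 (suc n) = trans (ℚP.+-identityʳ _) (sumTo-0 n)

sumTo-+ : ∀ n f g → sumTo n (λ i → f i + g i) ≡ sumTo n f + sumTo n g
sumTo-+ zero    f g = sym (ℚP.+-identityˡ 0ℚ)
sumTo-+ (suc n) f g = trans (cong (_+ (f n + g n)) (sumTo-+ n f g))
  (solve 4 (λ a b c d → (a :+ b) :+ (c :+ d) := (a :+ c) :+ (b :+ d)) refl (sumTo n f) (sumTo n g) (f n) (g n))

sumTo-- : ∀ n f g → sumTo n f - sumTo n g ≡ sumTo n (λ i → f i - g i)
sumTo-- zero    f g = refl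
sumTo-- (suc n) f g = trans
  (solve 4 (λ a b c d → (a :+ b) :- (c :+ d) := (a :- c) :+ (b :- d)) refl (sumTo n f) (f n) (sumTo n g) (g n))
  (cong (_+ (f n - g n)) (sumTo-- n f g))

*-distribˡ-sumTo : ∀ n c f → c * sumTo n f ≡ sumTo n (λ i → c * f i)
*-distribˡ-sumTo zero    c f = ℚP.*-zeroʳ c
*-distribˡ-sumTo (suc n) c f = trans (ℚP.*-distribˡ-+ c _ _) (cong (_+ (c * f n)) (*-distribˡ-sumTo n c f))

*-distribʳ-sumTo : ∀ n c f → sumTo n f * c ≡ sumTo n (λ i → f i * c)
*-distribʳ-sumTo n c f = trans (ℚP.*-comm (sumTo n f) c)
  (trans (*-distribˡ-sumTo n c f) (sumTo-cong n (λ i _ → ℚP.*-comm c (f i))))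

prodTo-cong : ∀ n {f g} → (∀ i → f i ≡ g i) → prodTo n f ≡ prodTo n g
prodTo-cong zero    f≡g = refl
prodTo-cong (suc n) f≡g = cong₂ _*_ (prodTo-cong n f≡g) (f≡g n)

prodTo-unfoldˡ : ∀ n f → prodTo (suc n) f ≡ f 0 * prodTo n (f ∘ suc)
prodTo-unfoldˡ zero    f = trans (ℚP.*-identityˡ (f 0)) (sym (ℚP.*-identityʳ (f 0)))
prodTo-unfoldˡ (suc n) f = trans (cong (_* f (suc n)) (prodTo-unfoldˡ n f)) (ℚP.*-assoc (f 0) (prodTo n (f ∘ suc)) (f (suc n)))

prodTo-* : ∀ n f g → prodTo n (λ i → f i * g i) ≡ prodTo n f * prodTo n g
prodTo-* zero    f g = sym (ℚP.*-identityˡ 1ℚ)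
prodTo-* (suc n) f g = trans (cong (_* (f n * g n)) (prodTo-* n f g))
  (solve 4 (λ a b c d → (a :* b) :* (c :* d) := (a :* c) :* (b :* d)) refl (prodTo n f) (prodTo n g) (f n) (g n))

private variable
  A : Set

sumℚ-++ : ∀ (f : A → ℚ) xs ys → sumℚ (map f (xs ++ ys)) ≡ sumℚ (map f xs) + sumℚ (map f ys)
sumℚ-++ f []       ys = sym (ℚP.+-identityˡ _)
sumℚ-++ f (x ∷ xs) ys = trans (cong (λ e → f x + e) (sumℚ-++ f xs ys)) (sym (ℚP.+-assoc (f x) _ _))

sumℚ-concatMap : ∀ (f : List ℕ → ℚ) (g : A → List (List ℕ)) xs →
                 sumℚ (map f (concatMap g xs)) ≡ sumℚ (map (λ x → sumℚ (map f (g x))) xs)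
sumℚ-concatMap f g []       = refl
sumℚ-concatMap f g (x ∷ xs) = trans (sumℚ-++ f (g x) (concatMap g xs)) (cong (λ e → sumℚ (map f (g x)) + e) (sumℚ-concatMap f g xs))

sumℚ-cong : ∀ {f g : A → ℚ} xs → All (λ x → f x ≡ g x) xs → sumℚ (map f xs) ≡ sumℚ (map g xs)
sumℚ-cong []       []         = refl
sumℚ-cong (x ∷ xs) (fx≡gx ∷ eqs) = cong₂ _+_ fx≡gx (sumℚ-cong xs eqs)

sumℚ-0 : ∀ {f : A → ℚ} xs → All (λ x → f x ≡ 0ℚ) xs → sumℚ (map f xs) ≡ 0ℚ
sumℚ-0 []       []         = refl
sumℚ-0 (x ∷ xs) (fx≡0 ∷ eqs) = trans (cong₂ _+_ fx≡0 (sumℚ-0 xs eqs)) (ℚP.+-identityˡ 0ℚ)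

*-distribˡ-sumℚ : ∀ c (f : A → ℚ) xs → c * sumℚ (map f xs) ≡ sumℚ (map (λ x → c * f x) xs)
*-distribˡ-sumℚ c f []       = ℚP.*-zeroʳ c
*-distribˡ-sumℚ c f (x ∷ xs) = trans (ℚP.*-distribˡ-+ c (f x) _) (cong (λ e → c * f x + e) (*-distribˡ-sumℚ c f xs))

sumℚ-+ : ∀ (f g : A → ℚ) xs → sumℚ (map (λ x → f x + g x) xs) ≡ sumℚ (map f xs) + sumℚ (map g xs)
sumℚ-+ f g []       = sym (ℚP.+-identityˡ 0ℚ)
sumℚ-+ f g (x ∷ xs) = trans (cong (λ e → (f x + g x) + e) (sumℚ-+ f g xs))
  (solve 4 (λ a b c d → (a :+ b) :+ (c :+ d) := (a :+ c) :+ (b :+ d)) refl (f x) (g x) (sumℚ (map f xs)) (sumℚ (map g xs)))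

sumℚ-upTo : ∀ n f → sumℚ (map f (upTo n)) ≡ sumTo n f
sumℚ-upTo zero    f = refl
sumℚ-upTo (suc n) f = begin
  sumℚ (map f (upTo (suc n)))                 ≡⟨ cong (sumℚ ∘ map f) (sym (ListP.applyUpTo-∷ʳ (λ i → i) n)) ⟩
  sumℚ (map f (upTo n ++ [ n ]))              ≡⟨ sumℚ-++ f (upTo n) [ n ] ⟩
  sumℚ (map f (upTo n)) + (f n + 0ℚ)          ≡⟨ cong₂ _+_ (sumℚ-upTo n f) (ℚP.+-identityʳ (f n)) ⟩
  sumTo (suc n) f                             ∎

H-cons : ∀ N a s → H N (a ∷ s) ≡ sumTo N (λ j → invPow j a * H j s)
H-cons N a s = sumℚ-upTo N (λ j → invPow j a * H j s)

H-suc : ∀ N a s → H (suc N) (a ∷ s) ≡ H N (a ∷ s) + invPow N a * H N s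
H-suc N a s = trans (H-cons (suc N) a s) (cong (_+ invPow N a * H N s) (sym (H-cons N a s)))

H-<length : ∀ N s → N ℕ.< length s → H N s ≡ 0ℚ
H-<length N (a ∷ s) (s≤s N≤∣s∣) = trans (H-cons N a s)
  (trans (sumTo-cong N (λ j j<N → trans (cong (invPow j a *_) (H-<length j s (ℕP.<-≤-trans j<N N≤∣s∣))) (ℚP.*-zeroʳ (invPow j a))))
         (sumTo-0 N))

module _ {p : ℕ} (p-prime : Prime p) where

  div-sumTo : ∀ {k} n f → (∀ i → i ℕ.< n → Div[ p ^ k ] (f i)) → Div[ p ^ k ] (sumTo n f)
  div-sumTo zero    f _   = div-0 p-prime
  div-sumTo (suc n) f div = div-+ p-prime (div-sumTo n f (λ i i<n → div i (ℕP.m<n⇒m<1+n i<n))) (div n (ℕP.n<1+n n))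

  div-H : ∀ N s → N ℕ.< p → Div[ p ^ 0 ] (H N s)
  div-H N []      _   = div-cong ι-1 (div-ι p-prime (+ 1))
  div-H N (a ∷ s) N<p = div-cong (sym (H-cons N a s)) (div-sumTo N _ (λ j j<N →
    div-* p-prime (div-invPow p-prime j a (ℕP.≤-<-trans j<N N<p)) (div-H j s (ℕP.<-trans j<N N<p))))

-- Formal ℚ-combinations of multiple harmonic sums

Combination : Set
Combination = List (ℚ × Composition)

⟦_⟧ : Combination → ℕ → ℚ
⟦ []          ⟧ N = 0ℚ
⟦ (c , s) ∷ L ⟧ N = c * H N s + ⟦ L ⟧ N

IsCompositionOf : ℕ → Composition → Set
IsCompositionOf w s = weight s ≡ w × All (1 ℕ.≤_) s

Homogeneous : ℕ → Combination → Set
Homogeneous w = All (IsCompositionOf w ∘ proj₂)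

homogeneous-≡ : ∀ {w w′ L} → w ≡ w′ → Homogeneous w L → Homogeneous w′ L
homogeneous-≡ refl hom = hom

⟦⟧-++ : ∀ L L′ N → ⟦ L ++ L′ ⟧ N ≡ ⟦ L ⟧ N + ⟦ L′ ⟧ N
⟦⟧-++ []            L′ N = sym (ℚP.+-identityˡ _)
⟦⟧-++ ((c , s) ∷ L) L′ N = trans (cong (λ e → c * H N s + e) (⟦⟧-++ L L′ N)) (sym (ℚP.+-assoc (c * H N s) (⟦ L ⟧ N) (⟦ L′ ⟧ N)))

scale : ℚ → Combination → Combination
scale c = map (λ (d , s) → (c * d , s))

⟦scale⟧ : ∀ c L N → ⟦ scale c L ⟧ N ≡ c * ⟦ L ⟧ N
⟦scale⟧ c []            N = sym (ℚP.*-zeroʳ c)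
⟦scale⟧ c ((d , s) ∷ L) N = trans (cong₂ _+_ (ℚP.*-assoc c d (H N s)) (⟦scale⟧ c L N)) (sym (ℚP.*-distribˡ-+ c (d * H N s) (⟦ L ⟧ N)))

scale-homogeneous : ∀ {w} c L → Homogeneous w L → Homogeneous w (scale c L)
scale-homogeneous c L hom = AllP.map⁺ (All.map (λ x → x) hom)

prepend : ℕ → Combination → Combination
prepend a = map (λ (c , u) → (c , a ∷ u))

⟦prepend⟧-zero : ∀ a L → ⟦ prepend a L ⟧ 0 ≡ 0ℚ
⟦prepend⟧-zero a []            = refl
⟦prepend⟧-zero a ((c , u) ∷ L) = trans (cong₂ _+_ (ℚP.*-zeroʳ c) (⟦prepend⟧-zero a L)) (ℚP.+-identityˡ 0ℚ)

⟦prepend⟧-suc : ∀ a L N → ⟦ prepend a L ⟧ (suc N) ≡ ⟦ prepend a L ⟧ N + invPow N a * ⟦ L ⟧ N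
⟦prepend⟧-suc a []            N = sym (trans (ℚP.+-identityˡ _) (ℚP.*-zeroʳ (invPow N a)))
⟦prepend⟧-suc a ((c , u) ∷ L) N = begin
  c * H (suc N) (a ∷ u) + ⟦ prepend a L ⟧ (suc N)                  ≡⟨ cong₂ (λ h e → c * h + e) (H-suc N a u) (⟦prepend⟧-suc a L N) ⟩
  c * (H N (a ∷ u) + x * H N u) + (⟦ prepend a L ⟧ N + x * ⟦ L ⟧ N) ≡⟨ solve 6 (λ c A x h E F → c :* (A :+ x :* h) :+ (E :+ x :* F) := (c :* A :+ E) :+ x :* (c :* h :+ F)) refl c (H N (a ∷ u)) x (H N u) (⟦ prepend a L ⟧ N) (⟦ L ⟧ N) ⟩
  (c * H N (a ∷ u) + ⟦ prepend a L ⟧ N) + x * (c * H N u + ⟦ L ⟧ N) ∎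
  where x = invPow N a

prepend-homogeneous : ∀ {w} a L → 1 ℕ.≤ a → Homogeneous w L → Homogeneous (a ℕ.+ w) (prepend a L)
prepend-homogeneous a L 1≤a hom = AllP.map⁺ (All.map (λ (∣u∣≡w , u>0) → cong (a ℕ.+_) ∣u∣≡w , 1≤a ∷ u>0) hom)

stuffle : Composition → Composition → Combination
stuffle []      t       = [ (1ℚ , t) ]
stuffle (a ∷ s) []      = [ (1ℚ , a ∷ s) ]
stuffle (a ∷ s) (b ∷ t) = prepend a (stuffle s (b ∷ t)) ++ (prepend b (stuffle (a ∷ s) t) ++ prepend (a ℕ.+ b) (stuffle s t))

H-*-stuffle : ∀ s t N → H N s * H N t ≡ ⟦ stuffle s t ⟧ N
H-*-stuffle []      t  N = sym (ℚP.+-identityʳ _)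
H-*-stuffle (a ∷ s) [] N = trans (ℚP.*-comm (H N (a ∷ s)) 1ℚ) (sym (ℚP.+-identityʳ _))
H-*-stuffle (a ∷ s) (b ∷ t) = induct
  where
  L₁ = stuffle s (b ∷ t)
  L₂ = stuffle (a ∷ s) t
  L₃ = stuffle s t
  R : ℕ → ℚ
  R N = ⟦ prepend a L₁ ⟧ N + (⟦ prepend b L₂ ⟧ N + ⟦ prepend (a ℕ.+ b) L₃ ⟧ N)
  ⟦stuffle⟧≡R : ∀ N → ⟦ stuffle (a ∷ s) (b ∷ t) ⟧ N ≡ R N
  ⟦stuffle⟧≡R N = trans (⟦⟧-++ (prepend a L₁) _ N) (cong (λ e → ⟦ prepend a L₁ ⟧ N + e) (⟦⟧-++ (prepend b L₂) _ N))
  induct : ∀ N → H N (a ∷ s) * H N (b ∷ t) ≡ ⟦ stuffle (a ∷ s) (b ∷ t) ⟧ N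
  induct zero = trans (ℚP.*-zeroˡ 0ℚ) (sym (trans (⟦stuffle⟧≡R 0)
    (cong₂ _+_ (⟦prepend⟧-zero a L₁) (cong₂ _+_ (⟦prepend⟧-zero b L₂) (⟦prepend⟧-zero (a ℕ.+ b) L₃)))))
  induct (suc N) = begin
    H (suc N) (a ∷ s) * H (suc N) (b ∷ t)
      ≡⟨ cong₂ _*_ (H-suc N a s) (H-suc N b t) ⟩
    (Hₐ + x * Hs) * (H_b + y * Ht)
      ≡⟨ solve 6 (λ A x Hs B y Ht → (A :+ x :* Hs) :* (B :+ y :* Ht) := A :* B :+ (x :* (Hs :* B) :+ (y :* (A :* Ht) :+ (x :* y) :* (Hs :* Ht)))) refl Hₐ x Hs H_b y Ht ⟩
    Hₐ * H_b + (x * (Hs * H_b) + (y * (Hₐ * Ht) + (x * y) * (Hs * Ht)))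
      ≡⟨ cong₂ _+_ (trans (induct N) (⟦stuffle⟧≡R N)) (cong₂ _+_ (cong (x *_) (H-*-stuffle s (b ∷ t) N))
           (cong₂ _+_ (cong (y *_) (H-*-stuffle (a ∷ s) t N)) (cong₂ _*_ (sym (invPow-+ N a b)) (H-*-stuffle s t N)))) ⟩
    R N + (x * ⟦ L₁ ⟧ N + (y * ⟦ L₂ ⟧ N + z * ⟦ L₃ ⟧ N))
      ≡⟨ solve 9 (λ P Q S x e₁ y e₂ z e₃ → (P :+ (Q :+ S)) :+ (x :* e₁ :+ (y :* e₂ :+ z :* e₃)) := (P :+ x :* e₁) :+ ((Q :+ y :* e₂) :+ (S :+ z :* e₃))) refl
           (⟦ prepend a L₁ ⟧ N) (⟦ prepend b L₂ ⟧ N) (⟦ prepend (a ℕ.+ b) L₃ ⟧ N) x (⟦ L₁ ⟧ N) y (⟦ L₂ ⟧ N) z (⟦ L₃ ⟧ N) ⟩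
    (⟦ prepend a L₁ ⟧ N + x * ⟦ L₁ ⟧ N) + ((⟦ prepend b L₂ ⟧ N + y * ⟦ L₂ ⟧ N) + (⟦ prepend (a ℕ.+ b) L₃ ⟧ N + z * ⟦ L₃ ⟧ N))
      ≡⟨ sym (cong₂ _+_ (⟦prepend⟧-suc a L₁ N) (cong₂ _+_ (⟦prepend⟧-suc b L₂ N) (⟦prepend⟧-suc (a ℕ.+ b) L₃ N))) ⟩
    R (suc N)
      ≡⟨ sym (⟦stuffle⟧≡R (suc N)) ⟩
    ⟦ stuffle (a ∷ s) (b ∷ t) ⟧ (suc N) ∎
    where
    Hₐ = H N (a ∷ s)
    H_b = H N (b ∷ t)
    Hs = H N s
    Ht = H N t
    x = invPow N a
    y = invPow N b
    z = invPow N (a ℕ.+ b)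

stuffle-homogeneous : ∀ s t → All (1 ℕ.≤_) s → All (1 ℕ.≤_) t → Homogeneous (weight s ℕ.+ weight t) (stuffle s t)
stuffle-homogeneous []      t       _ t>0 = (refl , t>0) ∷ []
stuffle-homogeneous (a ∷ s) []      s>0 _ = (sym (ℕP.+-identityʳ _) , s>0) ∷ []
stuffle-homogeneous (a ∷ s) (b ∷ t) (a>0 ∷ s>0) (b>0 ∷ t>0) =
  AllP.++⁺ (homogeneous-≡ (sym (ℕP.+-assoc a (weight s) (b ℕ.+ weight t)))
              (prepend-homogeneous a _ a>0 (stuffle-homogeneous s (b ∷ t) s>0 (b>0 ∷ t>0))))
  (AllP.++⁺ (homogeneous-≡ (sym (swap a (weight s) b (weight t)))
              (prepend-homogeneous b _ b>0 (stuffle-homogeneous (a ∷ s) t (a>0 ∷ s>0) t>0)))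
            (homogeneous-≡ (sym (interchange a (weight s) b (weight t)))
              (prepend-homogeneous (a ℕ.+ b) _ (ℕP.≤-trans a>0 (ℕP.m≤m+n a b)) (stuffle-homogeneous s t s>0 t>0))))
  where
  swap : ∀ a s b t → (a ℕ.+ s) ℕ.+ (b ℕ.+ t) ≡ b ℕ.+ ((a ℕ.+ s) ℕ.+ t)
  swap = solve-∀
  interchange : ∀ a s b t → (a ℕ.+ s) ℕ.+ (b ℕ.+ t) ≡ (a ℕ.+ b) ℕ.+ (s ℕ.+ t)
  interchange = solve-∀

_⊛₁_ : ℚ × Composition → Combination → Combination
(c , s) ⊛₁ []            = []
(c , s) ⊛₁ ((d , t) ∷ L) = scale (c * d) (stuffle s t) ++ (c , s) ⊛₁ L

_⊛_ : Combination → Combination → Combination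
[]      ⊛ L′ = []
(x ∷ L) ⊛ L′ = x ⊛₁ L′ ++ L ⊛ L′

⟦⊛₁⟧ : ∀ c s L N → ⟦ (c , s) ⊛₁ L ⟧ N ≡ (c * H N s) * ⟦ L ⟧ N
⟦⊛₁⟧ c s []            N = sym (ℚP.*-zeroʳ (c * H N s))
⟦⊛₁⟧ c s ((d , t) ∷ L) N = begin
  ⟦ scale (c * d) (stuffle s t) ++ (c , s) ⊛₁ L ⟧ N         ≡⟨ ⟦⟧-++ (scale (c * d) (stuffle s t)) _ N ⟩
  ⟦ scale (c * d) (stuffle s t) ⟧ N + ⟦ (c , s) ⊛₁ L ⟧ N    ≡⟨ cong₂ _+_ (trans (⟦scale⟧ (c * d) (stuffle s t) N) (cong ((c * d) *_) (sym (H-*-stuffle s t N)))) (⟦⊛₁⟧ c s L N) ⟩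
  (c * d) * (H N s * H N t) + (c * H N s) * ⟦ L ⟧ N          ≡⟨ solve 5 (λ c d hs ht e → (c :* d) :* (hs :* ht) :+ (c :* hs) :* e := (c :* hs) :* (d :* ht :+ e)) refl c d (H N s) (H N t) (⟦ L ⟧ N) ⟩
  (c * H N s) * (d * H N t + ⟦ L ⟧ N)                        ∎

⟦⊛⟧ : ∀ L L′ N → ⟦ L ⊛ L′ ⟧ N ≡ ⟦ L ⟧ N * ⟦ L′ ⟧ N
⟦⊛⟧ []            L′ N = sym (ℚP.*-zeroˡ (⟦ L′ ⟧ N))
⟦⊛⟧ ((c , s) ∷ L) L′ N = trans (⟦⟧-++ ((c , s) ⊛₁ L′) _ N)
  (trans (cong₂ _+_ (⟦⊛₁⟧ c s L′ N) (⟦⊛⟧ L L′ N)) (sym (ℚP.*-distribʳ-+ (⟦ L′ ⟧ N) (c * H N s) (⟦ L ⟧ N))))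

⊛₁-homogeneous : ∀ {v w} c s L → IsCompositionOf v s → Homogeneous w L → Homogeneous (v ℕ.+ w) ((c , s) ⊛₁ L)
⊛₁-homogeneous c s []            _             []                  = []
⊛₁-homogeneous c s ((d , t) ∷ L) (∣s∣≡v , s>0) ((∣t∣≡w , t>0) ∷ hom) =
  AllP.++⁺ (scale-homogeneous (c * d) (stuffle s t) (homogeneous-≡ (cong₂ ℕ._+_ ∣s∣≡v ∣t∣≡w) (stuffle-homogeneous s t s>0 t>0)))
           (⊛₁-homogeneous c s L (∣s∣≡v , s>0) hom)

⊛-homogeneous : ∀ {v w} L L′ → Homogeneous v L → Homogeneous w L′ → Homogeneous (v ℕ.+ w) (L ⊛ L′)
⊛-homogeneous []            L′ []          _    = []
⊛-homogeneous ((c , s) ∷ L) L′ (s-ok ∷ hom) hom′ = AllP.++⁺ (⊛₁-homogeneous c s L′ s-ok hom′) (⊛-homogeneous L L′ hom hom′)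

MHSCombination : ℕ → (ℕ → ℚ) → Set
MHSCombination w f = Σ Combination λ L → Homogeneous w L × (∀ N → f N ≡ ⟦ L ⟧ N)

mhs-0 : ∀ {w} → MHSCombination w (λ _ → 0ℚ)
mhs-0 = [] , [] , λ _ → refl

mhs-H : ∀ {w} c s → IsCompositionOf w s → MHSCombination w (λ N → c * H N s)
mhs-H c s s-ok = [ (c , s) ] , s-ok ∷ [] , λ _ → sym (ℚP.+-identityʳ _)

mhs-cong : ∀ {w f g} → (∀ N → f N ≡ g N) → MHSCombination w g → MHSCombination w f
mhs-cong f≡g (L , hom , g≡L) = L , hom , λ N → trans (f≡g N) (g≡L N)

mhs-≡weight : ∀ {w w′ f} → w ≡ w′ → MHSCombination w f → MHSCombination w′ f
mhs-≡weight refl mhs = mhs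

mhs-+ : ∀ {w f g} → MHSCombination w f → MHSCombination w g → MHSCombination w (λ N → f N + g N)
mhs-+ (L , hom , f≡L) (L′ , hom′ , g≡L′) =
  L ++ L′ , AllP.++⁺ hom hom′ , λ N → trans (cong₂ _+_ (f≡L N) (g≡L′ N)) (sym (⟦⟧-++ L L′ N))

mhs-scale : ∀ {w f} c → MHSCombination w f → MHSCombination w (λ N → c * f N)
mhs-scale c (L , hom , f≡L) = scale c L , scale-homogeneous c L hom , λ N → trans (cong (c *_) (f≡L N)) (sym (⟦scale⟧ c L N))

mhs-neg : ∀ {w f} → MHSCombination w f → MHSCombination w (λ N → - f N)
mhs-neg {f = f} mhs = mhs-cong (λ N → trans (cong -_ (sym (ℚP.*-identityˡ (f N)))) (ℚP.neg-distribˡ-* 1ℚ (f N))) (mhs-scale (- 1ℚ) mhs)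

mhs-* : ∀ {v w f g} → MHSCombination v f → MHSCombination w g → MHSCombination (v ℕ.+ w) (λ N → f N * g N)
mhs-* (L , hom , f≡L) (L′ , hom′ , g≡L′) =
  L ⊛ L′ , ⊛-homogeneous L L′ hom hom′ , λ N → trans (cong₂ _*_ (f≡L N) (g≡L′ N)) (sym (⟦⊛⟧ L L′ N))

mhs-sumTo : ∀ {w} m (F : ℕ → ℕ → ℚ) → (∀ i → i ℕ.< m → MHSCombination w (F i)) → MHSCombination w (λ N → sumTo m (λ i → F i N))
mhs-sumTo zero    F _   = mhs-0
mhs-sumTo (suc m) F mhs = mhs-+ (mhs-sumTo m F (λ i i<m → mhs i (ℕP.m<n⇒m<1+n i<m))) (mhs m (ℕP.n<1+n m))

bumpHead : Composition → List Composition
bumpHead []       = []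
bumpHead (x ∷ xs) = [ suc x ∷ xs ]

compositionsOf-suc : ∀ w → compositionsOf (suc w) ≡ map (1 ∷_) (compositionsOf w) ++ concatMap bumpHead (compositionsOf w)
compositionsOf-suc w = cong (map (1 ∷_) (compositionsOf w) ++_)
  (ListP.concatMap-cong (λ { [] → refl ; (x ∷ xs) → refl }) (compositionsOf w))

sumℚ-compositionsOf-suc : ∀ w f → sumℚ (map f (compositionsOf (suc w))) ≡
  sumℚ (map (f ∘ (1 ∷_)) (compositionsOf w)) + sumℚ (map (λ u → sumℚ (map f (bumpHead u))) (compositionsOf w))
sumℚ-compositionsOf-suc w f = begin
  sumℚ (map f (compositionsOf (suc w)))
    ≡⟨ cong (sumℚ ∘ map f) (compositionsOf-suc w) ⟩
  sumℚ (map f (map (1 ∷_) (compositionsOf w) ++ concatMap bumpHead (compositionsOf w)))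
    ≡⟨ sumℚ-++ f (map (1 ∷_) (compositionsOf w)) _ ⟩
  sumℚ (map f (map (1 ∷_) (compositionsOf w))) + sumℚ (map f (concatMap bumpHead (compositionsOf w)))
    ≡⟨ cong₂ _+_ (cong sumℚ (sym (ListP.map-∘ (compositionsOf w)))) (sumℚ-concatMap f bumpHead (compositionsOf w)) ⟩
  sumℚ (map (f ∘ (1 ∷_)) (compositionsOf w)) + sumℚ (map (λ u → sumℚ (map f (bumpHead u))) (compositionsOf w)) ∎

compositionsOf-ok : ∀ w → All (IsCompositionOf w) (compositionsOf w)
compositionsOf-ok zero    = (refl , []) ∷ []
compositionsOf-ok (suc w) = subst (All (IsCompositionOf (suc w))) (sym (compositionsOf-suc w))
  (AllP.++⁺ (AllP.map⁺ (All.map (λ (∣u∣≡w , u>0) → cong suc ∣u∣≡w , s≤s z≤n ∷ u>0) (compositionsOf-ok w)))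
            (bump (compositionsOf w) (compositionsOf-ok w)))
  where
  bump : ∀ us → All (IsCompositionOf w) us → All (IsCompositionOf (suc w)) (concatMap bumpHead us)
  bump []             []                          = []
  bump ([] ∷ us)      (_ ∷ ok)                    = bump us ok
  bump ((y ∷ u) ∷ us) ((∣yu∣≡w , _ ∷ u>0) ∷ ok) = (cong suc ∣yu∣≡w , s≤s z≤n ∷ u>0) ∷ bump us ok

δ : Composition → Composition → ℚ
δ []      []      = 1ℚ
δ []      (_ ∷ _) = 0ℚ
δ (_ ∷ _) []      = 0ℚ
δ (a ∷ s) (b ∷ t) = if a ℕ.≡ᵇ b then δ s t else 0ℚ

sumℚ-δ : ∀ w s → IsCompositionOf w s → (h : Composition → ℚ) → sumℚ (map (λ v → δ s v * h v) (compositionsOf w)) ≡ h s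
sumℚ-δ zero    []      _                h = trans (ℚP.+-identityʳ _) (ℚP.*-identityˡ (h []))
sumℚ-δ zero    (a ∷ s) (∣as∣≡0 , s≤s _ ∷ _) h with () ← ∣as∣≡0
sumℚ-δ (suc w) []      (() , _)         h
sumℚ-δ (suc w) (zero ∷ s) (_ , () ∷ _)  h
sumℚ-δ (suc w) (suc zero ∷ s) (∣1s∣≡w+1 , _ ∷ s>0) h = begin
  sumℚ (map f (compositionsOf (suc w)))
    ≡⟨ sumℚ-compositionsOf-suc w f ⟩
  sumℚ (map (f ∘ (1 ∷_)) (compositionsOf w)) + sumℚ (map (λ u → sumℚ (map f (bumpHead u))) (compositionsOf w))
    ≡⟨ cong₂ _+_ (sumℚ-δ w s (ℕP.suc-injective ∣1s∣≡w+1 , s>0) (h ∘ (1 ∷_))) (sumℚ-0 (compositionsOf w) (bumped-0 _ (compositionsOf-ok w))) ⟩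
  h (1 ∷ s) + 0ℚ
    ≡⟨ ℚP.+-identityʳ _ ⟩
  h (1 ∷ s) ∎
  where
  f = λ v → δ (1 ∷ s) v * h v
  bumped-0 : ∀ us → All (IsCompositionOf w) us → All (λ u → sumℚ (map f (bumpHead u)) ≡ 0ℚ) us
  bumped-0 []                   []                = []
  bumped-0 ([] ∷ us)            (_ ∷ ok)          = refl ∷ bumped-0 us ok
  bumped-0 ((suc y ∷ u) ∷ us)   ((_ , _ ∷ _) ∷ ok) = trans (ℚP.+-identityʳ _) (ℚP.*-zeroˡ (h (suc (suc y) ∷ u))) ∷ bumped-0 us ok
sumℚ-δ (suc w) (suc (suc x) ∷ s) (∣s∣≡w+1 , _ ∷ s>0) h = begin
  sumℚ (map f (compositionsOf (suc w)))
    ≡⟨ sumℚ-compositionsOf-suc w f ⟩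
  sumℚ (map (f ∘ (1 ∷_)) (compositionsOf w)) + sumℚ (map (λ u → sumℚ (map f (bumpHead u))) (compositionsOf w))
    ≡⟨ cong₂ _+_ (sumℚ-0 (compositionsOf w) (All.tabulate (λ {u} _ → ℚP.*-zeroˡ (h (1 ∷ u)))))
                 (sumℚ-cong (compositionsOf w) (All.tabulate (λ {u} _ → unbump u))) ⟩
  0ℚ + sumℚ (map (λ u → δ (suc x ∷ s) u * h′ u) (compositionsOf w))
    ≡⟨ trans (ℚP.+-identityˡ _) (sumℚ-δ w (suc x ∷ s) (ℕP.suc-injective ∣s∣≡w+1 , s≤s z≤n ∷ s>0) h′) ⟩
  h (suc (suc x) ∷ s) ∎
  where
  f = λ v → δ (suc (suc x) ∷ s) v * h v
  h′ : Composition → ℚ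
  h′ []      = 0ℚ
  h′ (y ∷ u) = h (suc y ∷ u)
  unbump : ∀ u → sumℚ (map f (bumpHead u)) ≡ δ (suc x ∷ s) u * h′ u
  unbump []      = sym (ℚP.*-zeroˡ 0ℚ)
  unbump (y ∷ u) = ℚP.+-identityʳ _

coefficient : Combination → Composition → ℚ
coefficient []            v = 0ℚ
coefficient ((c , s) ∷ L) v = c * δ s v + coefficient L v

sumℚ-coefficient : ∀ w L N → Homogeneous w L → sumℚ (map (λ v → coefficient L v * H N v) (compositionsOf w)) ≡ ⟦ L ⟧ N
sumℚ-coefficient w []            N []           = sumℚ-0 (compositionsOf w) (All.tabulate (λ {v} _ → ℚP.*-zeroˡ (H N v)))
sumℚ-coefficient w ((c , s) ∷ L) N (s-ok ∷ hom) = begin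
  sumℚ (map (λ v → (c * δ s v + coefficient L v) * H N v) (compositionsOf w))
    ≡⟨ sumℚ-cong (compositionsOf w) (All.tabulate (λ {v} _ → solve 4 (λ c i k h → (c :* i :+ k) :* h := c :* (i :* h) :+ k :* h) refl c (δ s v) (coefficient L v) (H N v))) ⟩
  sumℚ (map (λ v → c * (δ s v * H N v) + coefficient L v * H N v) (compositionsOf w))
    ≡⟨ sumℚ-+ (λ v → c * (δ s v * H N v)) (λ v → coefficient L v * H N v) (compositionsOf w) ⟩
  sumℚ (map (λ v → c * (δ s v * H N v)) (compositionsOf w)) + sumℚ (map (λ v → coefficient L v * H N v) (compositionsOf w))
    ≡⟨ cong₂ _+_ (trans (sym (*-distribˡ-sumℚ c (λ v → δ s v * H N v) (compositionsOf w))) (cong (c *_) (sumℚ-δ w s s-ok (H N))))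
                 (sumℚ-coefficient w L N hom) ⟩
  c * H N s + ⟦ L ⟧ N ∎

truncatedSum-coefficient : ∀ (E : ℕ → Combination) → (∀ w → Homogeneous w (E w)) → ∀ n p →
  truncatedSum (λ s → coefficient (E (weight s)) s) n p ≡ sumTo n (λ w → pow p w * ⟦ E w ⟧ (p ∸ 1))
truncatedSum-coefficient E hom n p = begin
  sumℚ (map F (concatMap compositionsOf (upTo n)))                ≡⟨ sumℚ-concatMap F compositionsOf (upTo n) ⟩
  sumℚ (map (λ w → sumℚ (map F (compositionsOf w))) (upTo n))     ≡⟨ sumℚ-upTo n _ ⟩
  sumTo n (λ w → sumℚ (map F (compositionsOf w)))                 ≡⟨ sumTo-cong n (λ w _ → weight-w-part w) ⟩
  sumTo n (λ w → pow p w * ⟦ E w ⟧ (p ∸ 1))                       ∎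
  where
  F = λ s → coefficient (E (weight s)) s * ℕtoℚ (p ℕ.^ weight s) * H (p ∸ 1) s
  F≡ : ∀ {w} v → IsCompositionOf w v → F v ≡ pow p w * (coefficient (E w) v * H (p ∸ 1) v)
  F≡ v (refl , _) = trans (cong (λ z → coefficient (E (weight v)) v * z * H (p ∸ 1) v) (ℕtoℚ≡ι (p ℕ.^ weight v)))
    (solve 3 (λ a b c → a :* b :* c := b :* (a :* c)) refl (coefficient (E (weight v)) v) (pow p (weight v)) (H (p ∸ 1) v))
  weight-w-part : ∀ w → sumℚ (map F (compositionsOf w)) ≡ pow p w * ⟦ E w ⟧ (p ∸ 1)
  weight-w-part w = begin
    sumℚ (map F (compositionsOf w))
      ≡⟨ sumℚ-cong (compositionsOf w) (All.map (λ {v} → F≡ v) (compositionsOf-ok w)) ⟩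
    sumℚ (map (λ v → pow p w * (coefficient (E w) v * H (p ∸ 1) v)) (compositionsOf w))
      ≡⟨ sym (*-distribˡ-sumℚ (pow p w) (λ v → coefficient (E w) v * H (p ∸ 1) v) (compositionsOf w)) ⟩
    pow p w * sumℚ (map (λ v → coefficient (E w) v * H (p ∸ 1) v) (compositionsOf w))
      ≡⟨ cong (pow p w *_) (sumℚ-coefficient w (E w) (p ∸ 1) (hom w)) ⟩
    pow p w * ⟦ E w ⟧ (p ∸ 1) ∎

denominatorBound : Combination → ℕ
denominatorBound []            = 0
denominatorBound ((c , _) ∷ L) = suc (↧ₙ c) ℕ.⊔ denominatorBound L

maxBelow : ℕ → (ℕ → ℕ) → ℕ
maxBelow zero    g = 0
maxBelow (suc n) g = maxBelow n g ℕ.⊔ g n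

≤-maxBelow : ∀ n g i → i ℕ.< n → g i ℕ.≤ maxBelow n g
≤-maxBelow (suc n) g i (s≤s i≤n) with ℕP.m≤n⇒m<n∨m≡n i≤n
... | inj₁ i<n  = ℕP.≤-trans (≤-maxBelow n g i i<n) (ℕP.m≤m⊔n _ _)
... | inj₂ refl = ℕP.m≤n⊔m (maxBelow i g) (g i)

p∸1<p : ∀ {p} → Prime p → p ∸ 1 ℕ.< p
p∸1<p {suc p} _       = ℕP.n<1+n p
p∸1<p {zero}  0-prime = ⊥-elim (¬prime[0] 0-prime)

module _ {p : ℕ} (p-prime : Prime p) where

  div-⟦⟧ : ∀ L → denominatorBound L ℕ.≤ p → ∀ N → N ℕ.< p → Div[ p ^ 0 ] (⟦ L ⟧ N)
  div-⟦⟧ []            _       N _   = div-0 p-prime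
  div-⟦⟧ ((c , s) ∷ L) bound≤p N N<p = div-+ p-prime
    (div-* p-prime (div-den<p p-prime c (ℕP.≤-trans (ℕP.m≤m⊔n (suc (↧ₙ c)) (denominatorBound L)) bound≤p)) (div-H p-prime N s N<p))
    (div-⟦⟧ L (ℕP.≤-trans (ℕP.m≤n⊔m (suc (↧ₙ c)) _) bound≤p) N N<p)

  div-mhs : ∀ {w f} (mhs : MHSCombination w f) → denominatorBound (proj₁ mhs) ℕ.≤ p → Div[ p ^ 0 ] (f (p ∸ 1))
  div-mhs (L , _ , f≡L) bound≤p = div-cong (sym (f≡L (p ∸ 1))) (div-⟦⟧ L bound≤p (p ∸ 1) (p∸1<p p-prime))

powerSum : ℕ → (ℕ → ℚ) → ℕ → ℚ
powerSum p u n = sumTo n (λ i → pow p i * u i)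

-- Asymptotic representability with the sum grouped by weight: term w collects the α_s H(s) with w(s) = w.
record Expansion (a : ℕ → ℚ) : Set where
  field
    term       : ℕ → ℕ → ℚ
    term-mhs   : ∀ w → MHSCombination w (term w)
    congruence : ∀ n → ∃[ P ] (∀ p → Prime p → P ℕ.≤ p → Div[ p ^ n ] (a p - powerSum p (λ w → term w (p ∸ 1)) n))

  integralityBound : ℕ → ℕ
  integralityBound n = maxBelow n (λ w → denominatorBound (proj₁ (term-mhs w)))

  term-integral : ∀ n p → Prime p → integralityBound n ℕ.≤ p → ∀ w → w ℕ.< n → Div[ p ^ 0 ] (term w (p ∸ 1))
  term-integral n p p-prime bound≤p w w<n =
    div-mhs p-prime (term-mhs w) (ℕP.≤-trans (≤-maxBelow n (λ w → denominatorBound (proj₁ (term-mhs w))) w w<n) bound≤p)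

open Expansion

expansion⇒representable : ∀ {a} → Expansion a → AsymptoticallyRepresentable a
expansion⇒representable {a} ex = (λ s → coefficient (E (weight s)) s) , λ n _ → proj₁ (congruence ex n) , λ p p-prime P≤p →
  div⇒∣numerator p-prime (div-cong (cong (λ z → a p - z) (partialSum≡ n p)) (proj₂ (congruence ex n) p p-prime P≤p))
  where
  E : ℕ → Combination
  E w = proj₁ (term-mhs ex w)
  partialSum≡ : ∀ n p → powerSum p (λ w → term ex w (p ∸ 1)) n ≡ truncatedSum (λ s → coefficient (E (weight s)) s) n p
  partialSum≡ n p = trans (sumTo-cong n (λ w _ → cong (pow p w *_) (proj₂ (proj₂ (term-mhs ex w)) (p ∸ 1))))
    (sym (truncatedSum-coefficient E (λ w → proj₁ (proj₂ (term-mhs ex w))) n p))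

-- Cauchy products

conv : (ℕ → ℚ) → (ℕ → ℚ) → ℕ → ℚ
conv u v w = sumTo (suc w) (λ i → u i * v (w ∸ i))

powerSum-conv : ∀ p u v n → powerSum p (conv u v) n ≡ sumTo n (λ i → (pow p i * u i) * powerSum p v (n ∸ i))
powerSum-conv p u v zero    = refl
powerSum-conv p u v (suc n) = begin
  powerSum p (conv u v) n + pow p n * conv u v n
    ≡⟨ cong (_+ pow p n * conv u v n) (powerSum-conv p u v n) ⟩
  sumTo n g + pow p n * conv u v n
    ≡⟨ cong (_+ pow p n * conv u v n) (sym (trans (cong (λ z → sumTo n g + z) g-n≡0) (ℚP.+-identityʳ (sumTo n g)))) ⟩
  sumTo (suc n) g + pow p n * conv u v n
    ≡⟨ cong (λ z → sumTo (suc n) g + z) (*-distribˡ-sumTo (suc n) (pow p n) (λ i → u i * v (n ∸ i))) ⟩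
  sumTo (suc n) g + sumTo (suc n) (λ i → pow p n * (u i * v (n ∸ i)))
    ≡⟨ sym (sumTo-+ (suc n) g _) ⟩
  sumTo (suc n) (λ i → g i + pow p n * (u i * v (n ∸ i)))
    ≡⟨ sumTo-cong (suc n) (λ i i<n+1 → extend i (ℕP.≤-pred i<n+1)) ⟩
  sumTo (suc n) (λ i → (pow p i * u i) * powerSum p v (suc n ∸ i)) ∎
  where
  g = λ i → (pow p i * u i) * powerSum p v (n ∸ i)
  g-n≡0 : g n ≡ 0ℚ
  g-n≡0 = trans (cong (λ k → (pow p n * u n) * powerSum p v k) (ℕP.n∸n≡0 n)) (ℚP.*-zeroʳ (pow p n * u n))
  extend : ∀ i → i ℕ.≤ n → g i + pow p n * (u i * v (n ∸ i)) ≡ (pow p i * u i) * powerSum p v (suc n ∸ i)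
  extend i i≤n = begin
    (pow p i * u i) * powerSum p v (n ∸ i) + pow p n * (u i * v (n ∸ i))
      ≡⟨ cong (λ z → (pow p i * u i) * powerSum p v (n ∸ i) + z * (u i * v (n ∸ i))) (sym pⁱpⁿ⁻ⁱ≡pⁿ) ⟩
    (pow p i * u i) * powerSum p v (n ∸ i) + (pow p i * pow p (n ∸ i)) * (u i * v (n ∸ i))
      ≡⟨ solve 5 (λ a b s c d → (a :* b) :* s :+ (a :* c) :* (b :* d) := (a :* b) :* (s :+ c :* d)) refl (pow p i) (u i) (powerSum p v (n ∸ i)) (pow p (n ∸ i)) (v (n ∸ i)) ⟩
    (pow p i * u i) * powerSum p v (suc (n ∸ i))
      ≡⟨ cong (λ k → (pow p i * u i) * powerSum p v k) (sym (ℕP.+-∸-assoc 1 i≤n)) ⟩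
    (pow p i * u i) * powerSum p v (suc n ∸ i) ∎
    where
    pⁱpⁿ⁻ⁱ≡pⁿ : pow p i * pow p (n ∸ i) ≡ pow p n
    pⁱpⁿ⁻ⁱ≡pⁿ = trans (sym (pow-+ p i (n ∸ i))) (cong (pow p) (ℕP.m+[n∸m]≡n i≤n))

IntegralBelow : ℕ → ℕ → (ℕ → ℚ) → Set
IntegralBelow p n u = ∀ i → i ℕ.< n → Div[ p ^ 0 ] (u i)

module _ {p : ℕ} (p-prime : Prime p) where

  div-powerSum : ∀ u n → IntegralBelow p n u → Div[ p ^ 0 ] (powerSum p u n)
  div-powerSum u n int = div-sumTo p-prime n _ (λ i i<n → div-weaken z≤n (div-pow-* p-prime i (int i i<n)))

  div-powerSum-tail : ∀ v m l → IntegralBelow p (m ℕ.+ l) v → Div[ p ^ m ] (powerSum p v (m ℕ.+ l) - powerSum p v m)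
  div-powerSum-tail v m l int = div-cong (sym tail≡)
    (div-sumTo p-prime l _ (λ i i<l → div-weaken (ℕP.m≤m+n m i) (div-pow-* p-prime (m ℕ.+ i) (int (m ℕ.+ i) (ℕP.+-monoʳ-< m i<l)))))
    where
    tail = sumTo l (λ i → pow p (m ℕ.+ i) * v (m ℕ.+ i))
    tail≡ : powerSum p v (m ℕ.+ l) - powerSum p v m ≡ tail
    tail≡ = trans (cong (_- powerSum p v m) (sumTo-++ m l (λ i → pow p i * v i)))
      (solve 2 (λ a b → (a :+ b) :- a := b) refl (powerSum p v m) tail)

  div-powerSum-*-conv : ∀ u v n → IntegralBelow p n u → IntegralBelow p n v →
                        Div[ p ^ n ] (powerSum p u n * powerSum p v n - powerSum p (conv u v) n)
  div-powerSum-*-conv u v n int-u int-v = div-cong (sym difference≡) (div-sumTo p-prime n _ div-term)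
    where
    f = λ i → (pow p i * u i) * powerSum p v n
    g = λ i → (pow p i * u i) * powerSum p v (n ∸ i)
    difference≡ : powerSum p u n * powerSum p v n - powerSum p (conv u v) n ≡ sumTo n (λ i → f i - g i)
    difference≡ = trans (cong₂ _-_ (*-distribʳ-sumTo n (powerSum p v n) (λ i → pow p i * u i)) (powerSum-conv p u v n)) (sumTo-- n f g)
    div-term : ∀ i → i ℕ.< n → Div[ p ^ n ] (f i - g i)
    div-term i i<n = div-cong (sym (solve 3 (λ a s t → a :* s :- a :* t := a :* (s :- t)) refl (pow p i * u i) (powerSum p v n) (powerSum p v (n ∸ i))))
      (subst (λ k → Div[ p ^ k ] ((pow p i * u i) * (powerSum p v n - powerSum p v (n ∸ i)))) (ℕP.m+[n∸m]≡n i≤n)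
        (div-* p-prime (div-pow-* p-prime i (int-u i i<n))
          (subst (λ k → Div[ p ^ (n ∸ i) ] (powerSum p v k - powerSum p v (n ∸ i))) (ℕP.m∸n+n≡m i≤n)
            (div-powerSum-tail v (n ∸ i) i (λ j j< → int-v j (subst (j ℕ.<_) (ℕP.m∸n+n≡m i≤n) j<))))))
      where i≤n = ℕP.<⇒≤ i<n

  div-*-powerSum-conv : ∀ {x y} u v n → IntegralBelow p n u → IntegralBelow p n v →
    Div[ p ^ n ] (x - powerSum p u n) → Div[ p ^ n ] (y - powerSum p v n) → Div[ p ^ n ] (x * y - powerSum p (conv u v) n)
  div-*-powerSum-conv {x} {y} u v n int-u int-v x≈U y≈V =
    div-cong (sym xy-C≡) (div-+ p-prime (div-+ p-prime (div-*ʳ p-prime x≈U y-integral) (div-*ˡ p-prime (div-powerSum u n int-u) y≈V))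
                                        (div-powerSum-*-conv u v n int-u int-v))
    where
    U = powerSum p u n
    V = powerSum p v n
    C = powerSum p (conv u v) n
    xy-C≡ : x * y - C ≡ ((x - U) * y + U * (y - V)) + (U * V - C)
    xy-C≡ = solve 5 (λ x y U V C → x :* y :- C := ((x :- U) :* y :+ U :* (y :- V)) :+ (U :* V :- C)) refl x y U V C
    y-integral : Div[ p ^ 0 ] y
    y-integral = div-cong (solve 2 (λ y V → (y :- V) :+ V := y) refl y V) (div-+ p-prime (div-weaken z≤n y≈V) (div-powerSum v n int-v))

expansion-const : ∀ c → Expansion (λ _ → c)
expansion-const c = record { term = const-term ; term-mhs = mhs ; congruence = congruence′ }
  where
  const-term : ℕ → ℕ → ℚ
  const-term zero    _ = c
  const-term (suc w) _ = 0ℚ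
  mhs : ∀ w → MHSCombination w (const-term w)
  mhs zero    = mhs-cong (λ _ → sym (ℚP.*-identityʳ c)) (mhs-H c [] (refl , []))
  mhs (suc w) = mhs-0
  powerSum≡c : ∀ n p → powerSum p (λ w → const-term w (p ∸ 1)) (suc n) ≡ c
  powerSum≡c n p = begin
    powerSum p (λ w → const-term w (p ∸ 1)) (suc n)   ≡⟨ sumTo-unfoldˡ n _ ⟩
    pow p 0 * c + sumTo n (λ w → pow p (suc w) * 0ℚ)  ≡⟨ cong₂ _+_ (trans (cong (_* c) ι-1) (ℚP.*-identityˡ c)) (trans (sumTo-cong n (λ w _ → ℚP.*-zeroʳ (pow p (suc w)))) (sumTo-0 n)) ⟩
    c + 0ℚ                                            ≡⟨ ℚP.+-identityʳ c ⟩
    c                                                 ∎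
  congruence′ : ∀ n → ∃[ P ] (∀ p → Prime p → P ℕ.≤ p → Div[ p ^ n ] (c - powerSum p (λ w → const-term w (p ∸ 1)) n))
  congruence′ zero    = suc (↧ₙ c) , λ p p-prime ↧c<p → div-cong (sym (ℚP.+-identityʳ c)) (div-den<p p-prime c ↧c<p)
  congruence′ (suc n) = 0 , λ p p-prime _ → div-cong (sym (trans (cong (λ z → c - z) (powerSum≡c n p)) (ℚP.+-inverseʳ c))) (div-0 p-prime)

conv-mhs : ∀ {f g : ℕ → ℕ → ℚ} → (∀ w → MHSCombination w (f w)) → (∀ w → MHSCombination w (g w)) →
           ∀ w → MHSCombination w (λ N → conv (λ i → f i N) (λ i → g i N) w)
conv-mhs {f} {g} f-mhs g-mhs w = mhs-sumTo (suc w) (λ i N → f i N * g (w ∸ i) N)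
  (λ i i<w+1 → mhs-≡weight (ℕP.m+[n∸m]≡n (ℕP.≤-pred i<w+1)) (mhs-* {f = f i} {g = g (w ∸ i)} (f-mhs i) (g-mhs (w ∸ i))))

expansion-* : ∀ {a b} → Expansion a → Expansion b → Expansion (λ p → a p * b p)
expansion-* {a} {b} ex-a ex-b = record
  { term       = term′
  ; term-mhs   = conv-mhs {term ex-a} {term ex-b} (term-mhs ex-a) (term-mhs ex-b)
  ; congruence = congruence′
  }
  where
  term′ : ℕ → ℕ → ℚ
  term′ w N = conv (λ i → term ex-a i N) (λ i → term ex-b i N) w
  congruence′ : ∀ n → ∃[ P ] (∀ p → Prime p → P ℕ.≤ p → Div[ p ^ n ] (a p * b p - powerSum p (λ w → term′ w (p ∸ 1)) n))
  congruence′ n = (Pa ℕ.⊔ Pb) ℕ.⊔ (Ia ℕ.⊔ Ib) , congruence-at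
    where
    Pa = proj₁ (congruence ex-a n)
    Pb = proj₁ (congruence ex-b n)
    Ia = integralityBound ex-a n
    Ib = integralityBound ex-b n
    congruence-at : ∀ p → Prime p → (Pa ℕ.⊔ Pb) ℕ.⊔ (Ia ℕ.⊔ Ib) ℕ.≤ p → Div[ p ^ n ] (a p * b p - powerSum p (λ w → term′ w (p ∸ 1)) n)
    congruence-at p p-prime bound≤p = div-*-powerSum-conv p-prime {a p} {b p} (λ i → term ex-a i (p ∸ 1)) (λ i → term ex-b i (p ∸ 1)) n
      (term-integral ex-a n p p-prime (ℕP.m⊔n≤o⇒m≤o _ _ I≤p)) (term-integral ex-b n p p-prime (ℕP.m⊔n≤o⇒n≤o Ia _ I≤p))
      (proj₂ (congruence ex-a n) p p-prime (ℕP.m⊔n≤o⇒m≤o _ _ P≤p)) (proj₂ (congruence ex-b n) p p-prime (ℕP.m⊔n≤o⇒n≤o Pa _ P≤p))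
      where
      P≤p = ℕP.m⊔n≤o⇒m≤o (Pa ℕ.⊔ Pb) _ bound≤p
      I≤p = ℕP.m⊔n≤o⇒n≤o (Pa ℕ.⊔ Pb) _ bound≤p

Q : ℤ → ℕ → ℚ
Q l p = prodTo (p ∸ 1) (λ t → 1ℚ + (ι l * pow p 1) * invPow t 1)

-- H_N(1,…,1) with j ones is the j-th elementary symmetric function of 1, 1/2, …, 1/N.
prodTo≡sum-H-ones : ∀ x N M → N ℕ.< M → prodTo N (λ t → 1ℚ + x * invPow t 1) ≡ sumTo M (λ j → x ^ j * H N (replicate j 1))
prodTo≡sum-H-ones x zero (suc M) _ = sym (begin
  sumTo (suc M) (λ j → x ^ j * H 0 (replicate j 1))   ≡⟨ sumTo-unfoldˡ M _ ⟩
  1ℚ * 1ℚ + sumTo M (λ j → x ^ suc j * 0ℚ)          ≡⟨ cong (λ z → 1ℚ * 1ℚ + z) (trans (sumTo-cong M (λ j _ → ℚP.*-zeroʳ (x ^ suc j))) (sumTo-0 M)) ⟩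
  1ℚ * 1ℚ + 0ℚ                                       ≡⟨ ℚP.+-identityʳ _ ⟩
  1ℚ                                                 ∎)
prodTo≡sum-H-ones x (suc N) (suc M) (s≤s N<M) = begin
  prodTo N (λ t → 1ℚ + x * invPow t 1) * (1ℚ + x * y)   ≡⟨ cong (_* (1ℚ + x * y)) (prodTo≡sum-H-ones x N (suc M) (ℕP.m<n⇒m<1+n N<M)) ⟩
  (sumTo M f + f M) * (1ℚ + x * y)                      ≡⟨ cong (λ z → (sumTo M f + z) * (1ℚ + x * y)) f-M≡0 ⟩
  (sumTo M f + 0ℚ) * (1ℚ + x * y)                       ≡⟨ solve 3 (λ s x y → (s :+ con 0ℚ) :* (con 1ℚ :+ x :* y) := (s :+ con 0ℚ) :+ (x :* y) :* s) refl (sumTo M f) x y ⟩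
  (sumTo M f + 0ℚ) + (x * y) * sumTo M f                ≡⟨ cong (λ z → (sumTo M f + z) + (x * y) * sumTo M f) (sym f-M≡0) ⟩
  sumTo (suc M) f + (x * y) * sumTo M f                 ≡⟨ cong (_+ (x * y) * sumTo M f) (sumTo-unfoldˡ M f) ⟩
  (f 0 + sumTo M (f ∘ suc)) + (x * y) * sumTo M f       ≡⟨ ℚP.+-assoc (f 0) (sumTo M (f ∘ suc)) ((x * y) * sumTo M f) ⟩
  f 0 + (sumTo M (f ∘ suc) + (x * y) * sumTo M f)       ≡⟨ cong (λ z → f 0 + z) (sym g∘suc≡) ⟩
  f 0 + sumTo M (g ∘ suc)                               ≡⟨ sym (sumTo-unfoldˡ M g) ⟩
  sumTo (suc M) g                                       ∎
  where
  y = invPow N 1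
  f = λ j → x ^ j * H N (replicate j 1)
  g = λ j → x ^ j * H (suc N) (replicate j 1)
  f-M≡0 : f M ≡ 0ℚ
  f-M≡0 = trans (cong (x ^ M *_) (H-<length N (replicate M 1) (subst (N ℕ.<_) (sym (ListP.length-replicate M)) N<M))) (ℚP.*-zeroʳ (x ^ M))
  g∘suc≡ : sumTo M (g ∘ suc) ≡ sumTo M (f ∘ suc) + (x * y) * sumTo M f
  g∘suc≡ = begin
    sumTo M (g ∘ suc)                                        ≡⟨ sumTo-cong M (λ j _ → trans (cong ((x * x ^ j) *_) (H-suc N 1 (replicate j 1)))
                                                                 (solve 5 (λ x P A y B → (x :* P) :* (A :+ y :* B) := (x :* P) :* A :+ (x :* y) :* (P :* B)) refl x (x ^ j) (H N (1 ∷ replicate j 1)) y (H N (replicate j 1)))) ⟩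
    sumTo M (λ j → f (suc j) + (x * y) * f j)                ≡⟨ sumTo-+ M (f ∘ suc) (λ j → (x * y) * f j) ⟩
    sumTo M (f ∘ suc) + sumTo M (λ j → (x * y) * f j)        ≡⟨ cong (λ z → sumTo M (f ∘ suc) + z) (sym (*-distribˡ-sumTo M (x * y) f)) ⟩
    sumTo M (f ∘ suc) + (x * y) * sumTo M f                  ∎

ι-^ : ∀ p j → ι (+ p) ^ j ≡ pow p j
ι-^ p zero    = sym ι-1
ι-^ p (suc j) = trans (cong (ι (+ p) *_) (ι-^ p j)) (sym (ιℕ-* p (p ℕ.^ j)))

Expansion₁ : (ℕ → ℚ) → Set
Expansion₁ a = Σ (Expansion a) λ ex → ∀ N → term ex 0 N ≡ 1ℚ

expansion₁-Q : ∀ l → Expansion₁ (Q l)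
expansion₁-Q l = record { term = Q-term ; term-mhs = λ w → mhs-H (ι l ^ w) (replicate w 1) (ones-ok w) ; congruence = congruence′ }
               , λ _ → ℚP.*-identityˡ 1ℚ
  where
  Q-term : ℕ → ℕ → ℚ
  Q-term w N = ι l ^ w * H N (replicate w 1)
  ones-ok : ∀ j → IsCompositionOf j (replicate j 1)
  ones-ok zero    = refl , []
  ones-ok (suc j) = cong suc (proj₁ (ones-ok j)) , ℕP.≤-refl ∷ proj₂ (ones-ok j)
  Q≡powerSum : ∀ n p → Prime p → Q l p ≡ powerSum p (λ w → Q-term w (p ∸ 1)) (n ℕ.+ p)
  Q≡powerSum n p p-prime = trans (prodTo≡sum-H-ones (ι l * pow p 1) (p ∸ 1) (n ℕ.+ p) (ℕP.<-≤-trans (p∸1<p p-prime) (ℕP.m≤n+m p n)))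
    (sumTo-cong (n ℕ.+ p) (λ j _ → trans (cong (_* H (p ∸ 1) (replicate j 1)) (lpʲ≡ j)) (ℚP.*-assoc (pow p j) (ι l ^ j) _)))
    where
    lpʲ≡ : ∀ j → (ι l * pow p 1) ^ j ≡ pow p j * ι l ^ j
    lpʲ≡ j = begin
      (ι l * pow p 1) ^ j          ≡⟨ ^-distrib-* (ι l) (pow p 1) j ⟩
      ι l ^ j * pow p 1 ^ j        ≡⟨ cong (λ z → ι l ^ j * z ^ j) (cong (λ z → ι (+ z)) (ℕP.*-identityʳ p)) ⟩
      ι l ^ j * ι (+ p) ^ j        ≡⟨ cong (ι l ^ j *_) (ι-^ p j) ⟩
      ι l ^ j * pow p j            ≡⟨ ℚP.*-comm (ι l ^ j) (pow p j) ⟩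
      pow p j * ι l ^ j            ∎
  integral : ∀ p → Prime p → ∀ j → Div[ p ^ 0 ] (Q-term j (p ∸ 1))
  integral p p-prime j = div-* p-prime (ι-power j) (div-H p-prime (p ∸ 1) (replicate j 1) (p∸1<p p-prime))
    where
    ι-power : ∀ j → Div[ p ^ 0 ] (ι l ^ j)
    ι-power zero    = div-cong ι-1 (div-ι p-prime (+ 1))
    ι-power (suc j) = div-* p-prime (div-ι p-prime l) (ι-power j)
  congruence′ : ∀ n → ∃[ P ] (∀ p → Prime p → P ℕ.≤ p → Div[ p ^ n ] (Q l p - powerSum p (λ w → Q-term w (p ∸ 1)) n))
  congruence′ n = 0 , λ p p-prime _ → div-cong (cong (_- powerSum p _ n) (sym (Q≡powerSum n p p-prime)))
    (div-powerSum-tail p-prime (λ j → Q-term j (p ∸ 1)) n p (λ j _ → integral p p-prime j))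

expansion₁-* : ∀ {a b} → Expansion₁ a → Expansion₁ b → Expansion₁ (λ p → a p * b p)
expansion₁-* (ex-a , a₀≡1) (ex-b , b₀≡1) = expansion-* ex-a ex-b ,
  λ N → trans (ℚP.+-identityˡ _) (trans (cong₂ _*_ (a₀≡1 N) (b₀≡1 N)) (ℚP.*-identityˡ 1ℚ))

expansion₁-prodTo : ∀ r (F : ℕ → ℕ → ℚ) → (∀ m → Expansion₁ (F m)) → Expansion₁ (λ p → prodTo r (λ m → F m p))
expansion₁-prodTo zero    F _  = expansion-const 1ℚ , λ _ → refl
expansion₁-prodTo (suc r) F ex = expansion₁-* (expansion₁-prodTo r F ex) (ex r)

-- Division by an expansion with constant term 1

-- The coefficients g of the inverse series of Σ Dᵂ xʷ (with D⁰ = 1): g⁰ = 1 and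
-- g^{w+1} = - Σ_{i ≤ w} D^{i+1} g^{w-i}.  The fuel argument f > w makes the recursion structural.
inverseWithFuel : (ℕ → ℕ → ℚ) → ℕ → ℕ → ℕ → ℚ
inverseWithFuel D zero    w       N = 0ℚ
inverseWithFuel D (suc f) zero    N = 1ℚ
inverseWithFuel D (suc f) (suc w) N = - sumTo (suc w) (λ i → D (suc i) N * inverseWithFuel D f (w ∸ i) N)

inverseWithFuel-irrelevant : ∀ D f f′ w N → w ℕ.< f → w ℕ.< f′ → inverseWithFuel D f w N ≡ inverseWithFuel D f′ w N
inverseWithFuel-irrelevant D (suc f) (suc f′) zero    N _         _          = refl
inverseWithFuel-irrelevant D (suc f) (suc f′) (suc w) N (s≤s w<f) (s≤s w<f′) = cong -_ (sumTo-cong (suc w) (λ i _ →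
  cong (D (suc i) N *_) (inverseWithFuel-irrelevant D f f′ (w ∸ i) N (ℕP.≤-<-trans (ℕP.m∸n≤m w i) w<f) (ℕP.≤-<-trans (ℕP.m∸n≤m w i) w<f′))))

inverse : (ℕ → ℕ → ℚ) → ℕ → ℕ → ℚ
inverse D w = inverseWithFuel D (suc w) w

inverse-suc : ∀ D w N → inverse D (suc w) N ≡ - sumTo (suc w) (λ i → D (suc i) N * inverse D (w ∸ i) N)
inverse-suc D w N = cong -_ (sumTo-cong (suc w) (λ i _ →
  cong (D (suc i) N *_) (inverseWithFuel-irrelevant D (suc w) (suc (w ∸ i)) (w ∸ i) N (s≤s (ℕP.m∸n≤m w i)) (ℕP.n<1+n _))))

inverse-mhs : ∀ D → (∀ w → MHSCombination w (D w)) → ∀ w → MHSCombination w (inverse D w)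
inverse-mhs D D-mhs w = go w w ℕP.≤-refl
  where
  go : ∀ w j → j ℕ.≤ w → MHSCombination j (inverse D j)
  go w       zero    _         = mhs-cong (λ _ → sym (ℚP.*-identityˡ 1ℚ)) (mhs-H 1ℚ [] (refl , []))
  go (suc w) (suc j) (s≤s j≤w) = mhs-cong (inverse-suc D j) (mhs-neg (mhs-sumTo (suc j) (λ i N → D (suc i) N * inverse D (j ∸ i) N)
    (λ i i<j+1 → mhs-≡weight (cong suc (ℕP.m+[n∸m]≡n (ℕP.≤-pred i<j+1)))
      (mhs-* {f = D (suc i)} (D-mhs (suc i)) (go w (j ∸ i) (ℕP.≤-trans (ℕP.m∸n≤m j i) j≤w))))))

conv-inverse : ∀ D N → D 0 N ≡ 1ℚ → ∀ w → conv (λ i → D i N) (λ i → inverse D i N) (suc w) ≡ 0ℚ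
conv-inverse D N D₀≡1 w = begin
  conv (λ i → D i N) (λ i → inverse D i N) (suc w)      ≡⟨ sumTo-unfoldˡ (suc w) _ ⟩
  D 0 N * inverse D (suc w) N + T                       ≡⟨ cong (λ z → z * inverse D (suc w) N + T) D₀≡1 ⟩
  1ℚ * inverse D (suc w) N + T                          ≡⟨ cong (_+ T) (trans (ℚP.*-identityˡ _) (inverse-suc D w N)) ⟩
  - T + T                                               ≡⟨ ℚP.+-inverseˡ T ⟩
  0ℚ                                                    ∎
  where T = sumTo (suc w) (λ i → D (suc i) N * inverse D (w ∸ i) N)

powerSum-δ₀ : ∀ p (c : ℕ → ℚ) → c 0 ≡ 1ℚ → (∀ w → c (suc w) ≡ 0ℚ) → ∀ n → powerSum p c (suc n) ≡ 1ℚ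
powerSum-δ₀ p c c₀≡1 c₊≡0 n = begin
  powerSum p c (suc n)                             ≡⟨ sumTo-unfoldˡ n _ ⟩
  pow p 0 * c 0 + sumTo n (λ w → pow p (suc w) * c (suc w))
    ≡⟨ cong₂ _+_ (trans (cong₂ _*_ ι-1 c₀≡1) (ℚP.*-identityˡ 1ℚ))
                 (trans (sumTo-cong n (λ w _ → trans (cong (pow p (suc w) *_) (c₊≡0 w)) (ℚP.*-zeroʳ (pow p (suc w))))) (sumTo-0 n)) ⟩
  1ℚ + 0ℚ                                          ≡⟨ ℚP.+-identityʳ 1ℚ ⟩
  1ℚ                                               ∎

module _ {a c d : ℕ → ℚ} (ex-c : Expansion c) (ex-d : Expansion₁ d)
         (P₀ : ℕ) (a*d≡c : ∀ p → Prime p → P₀ ℕ.≤ p → a p * d p ≡ c p) where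

  private
    D = term (proj₁ ex-d)
    D₀≡1 = proj₂ ex-d
    g-mhs = inverse-mhs D (term-mhs (proj₁ ex-d))
    Pc = λ n → proj₁ (congruence ex-c n)
    Pd = λ n → proj₁ (congruence (proj₁ ex-d) n)
    Ig = λ n → maxBelow n (λ w → denominatorBound (proj₁ (g-mhs w)))

  integralBound : ℕ
  integralBound = P₀ ℕ.⊔ (Pc 0 ℕ.⊔ Pd 1)

  quotient-integral : ∀ p → Prime p → integralBound ℕ.≤ p → Div[ p ^ 0 ] (a p)
  quotient-integral p p-prime bound≤p = div-*-unit p-prime
    (div-cong (ℚP.+-identityʳ (c p)) (proj₂ (congruence ex-c 0) p p-prime (ℕP.m⊔n≤o⇒m≤o _ _ (ℕP.m⊔n≤o⇒n≤o P₀ _ bound≤p))))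
    (div-cong (cong (λ z → d p - z) (trans (ℚP.+-identityˡ _) (trans (cong₂ _*_ ι-1 (D₀≡1 (p ∸ 1))) (ℚP.*-identityˡ 1ℚ))))
      (proj₂ (congruence (proj₁ ex-d) 1) p p-prime (ℕP.m⊔n≤o⇒n≤o (Pc 0) _ (ℕP.m⊔n≤o⇒n≤o P₀ _ bound≤p))))
    (a*d≡c p p-prime (ℕP.m⊔n≤o⇒m≤o _ _ bound≤p))

  quotientBound : ℕ → ℕ
  quotientBound n = integralBound ℕ.⊔ ((Pc n ℕ.⊔ Pd n) ℕ.⊔ (integralityBound ex-c n ℕ.⊔ (integralityBound (proj₁ ex-d) n ℕ.⊔ Ig n)))

  quotient-term : ℕ → ℕ → ℚ
  quotient-term w N = conv (λ i → term ex-c i N) (λ i → inverse D i N) w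

  -- With G = Σ_{w<n} pʷ gʷ, both d·G ≡ 1 and c·G ≡ Σ_{w<n} pʷ (c ⋆ g)ʷ mod pⁿ, whence a ≡ a·(1 - d·G) + c·G.
  quotient-congruence : ∀ n p → Prime p → quotientBound (suc n) ℕ.≤ p →
    Div[ p ^ suc n ] (a p - powerSum p (λ w → quotient-term w (p ∸ 1)) (suc n))
  quotient-congruence n p p-prime bound≤p =
    div-cong (sym a≡) (div-+ p-prime (div-* p-prime (quotient-integral p p-prime (ℕP.m⊔n≤o⇒m≤o _ _ bound≤p)) (div-neg p-prime d*G≈1)) c*G≈)
    where
    m = suc n
    bound-P = ℕP.m⊔n≤o⇒m≤o _ _ (ℕP.m⊔n≤o⇒n≤o integralBound _ bound≤p)
    bound-I = ℕP.m⊔n≤o⇒n≤o (Pc m ℕ.⊔ Pd m) _ (ℕP.m⊔n≤o⇒n≤o integralBound _ bound≤p)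
    bound-Id = ℕP.m⊔n≤o⇒n≤o (integralityBound ex-c m) _ bound-I
    g = λ i → inverse D i (p ∸ 1)
    G = powerSum p g m
    g-integral : IntegralBelow p m g
    g-integral i i<m = div-mhs p-prime (g-mhs i)
      (ℕP.≤-trans (≤-maxBelow m (λ w → denominatorBound (proj₁ (g-mhs w))) i i<m) (ℕP.m⊔n≤o⇒n≤o (integralityBound (proj₁ ex-d) m) _ bound-Id))
    G≈G : Div[ p ^ m ] (G - G)
    G≈G = div-cong (sym (ℚP.+-inverseʳ G)) (div-0 p-prime)
    d*G≈1 : Div[ p ^ m ] (d p * G - 1ℚ)
    d*G≈1 = div-cong (cong (λ z → d p * G - z) (powerSum-δ₀ p _
              (trans (ℚP.+-identityˡ _) (trans (cong (_* g 0) (D₀≡1 (p ∸ 1))) (ℚP.*-identityˡ 1ℚ)))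
              (conv-inverse D (p ∸ 1) (D₀≡1 (p ∸ 1))) n))
      (div-*-powerSum-conv p-prime {d p} {G} (λ i → D i (p ∸ 1)) g m
        (term-integral (proj₁ ex-d) m p p-prime (ℕP.m⊔n≤o⇒m≤o _ _ bound-Id)) g-integral
        (proj₂ (congruence (proj₁ ex-d) m) p p-prime (ℕP.m⊔n≤o⇒n≤o (Pc m) _ bound-P)) G≈G)
    c*G≈ : Div[ p ^ m ] (c p * G - powerSum p (λ w → quotient-term w (p ∸ 1)) m)
    c*G≈ = div-*-powerSum-conv p-prime {c p} {G} (λ i → term ex-c i (p ∸ 1)) g m
      (term-integral ex-c m p p-prime (ℕP.m⊔n≤o⇒m≤o _ _ bound-I)) g-integral
      (proj₂ (congruence ex-c m) p p-prime (ℕP.m⊔n≤o⇒m≤o _ _ bound-P)) G≈G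
    S = powerSum p (λ w → quotient-term w (p ∸ 1)) m
    a≡ : a p - S ≡ a p * (- (d p * G - 1ℚ)) + (c p * G - S)
    a≡ = begin
      a p - S                                         ≡⟨ solve 4 (λ a d G t → a :- t := a :* (:- (d :* G :- con 1ℚ)) :+ ((a :* d) :* G :- t)) refl (a p) (d p) G S ⟩
      a p * (- (d p * G - 1ℚ)) + ((a p * d p) * G - S) ≡⟨ cong (λ z → a p * (- (d p * G - 1ℚ)) + (z * G - S)) (a*d≡c p p-prime (ℕP.m⊔n≤o⇒m≤o _ _ (ℕP.m⊔n≤o⇒m≤o _ _ bound≤p))) ⟩
      a p * (- (d p * G - 1ℚ)) + (c p * G - S)         ∎

  expansion-quotient : Expansion a
  expansion-quotient = record
    { term       = quotient-term
    ; term-mhs   = conv-mhs {term ex-c} {inverse D} (term-mhs ex-c) g-mhs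
    ; congruence = λ { zero    → integralBound , λ p p-prime bound≤p → div-cong (sym (ℚP.+-identityʳ (a p))) (quotient-integral p p-prime bound≤p)
                     ; (suc n) → quotientBound (suc n) , quotient-congruence n }
    }

-- The binomial identity

binom-suc : ∀ x m → binom x (suc m) * ι (+ suc m) ≡ binom x m * ι (x ℤ.- + m)
binom-suc x m = trans (ℚP.*-assoc (binom x m) _ _) (cong (binom x m *_) (/-*-ι (x ℤ.- + m) (suc m)))

binom-+-*-prodTo : ∀ x M L → binom x (M ℕ.+ L) * prodTo L (λ u → ι (+ suc (M ℕ.+ u))) ≡ binom x M * prodTo L (λ u → ι (x ℤ.- + (M ℕ.+ u)))
binom-+-*-prodTo x M zero    = cong (λ k → binom x k * 1ℚ) (ℕP.+-identityʳ M)
binom-+-*-prodTo x M (suc L) = begin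
  binom x (M ℕ.+ suc L) * (Π * ι (+ suc (M ℕ.+ L)))        ≡⟨ cong (λ k → binom x k * (Π * ι (+ suc (M ℕ.+ L)))) (ℕP.+-suc M L) ⟩
  (binom x (M ℕ.+ L) * q) * (Π * ι (+ suc (M ℕ.+ L)))      ≡⟨ solve 4 (λ B q P i → (B :* q) :* (P :* i) := (B :* P) :* (q :* i)) refl (binom x (M ℕ.+ L)) q Π (ι (+ suc (M ℕ.+ L))) ⟩
  (binom x (M ℕ.+ L) * Π) * (q * ι (+ suc (M ℕ.+ L)))      ≡⟨ cong₂ _*_ (binom-+-*-prodTo x M L) (/-*-ι (x ℤ.- + (M ℕ.+ L)) (suc (M ℕ.+ L))) ⟩
  (binom x M * Π′) * ι (x ℤ.- + (M ℕ.+ L))                 ≡⟨ ℚP.*-assoc (binom x M) Π′ _ ⟩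
  binom x M * (Π′ * ι (x ℤ.- + (M ℕ.+ L)))                 ∎
  where
  q = (x ℤ.- + (M ℕ.+ L)) / suc (M ℕ.+ L)
  Π = prodTo L (λ u → ι (+ suc (M ℕ.+ u)))
  Π′ = prodTo L (λ u → ι (x ℤ.- + (M ℕ.+ u)))

prodTo-ι-suc : ∀ n → prodTo n (λ t → ι (+ suc t)) ≡ ι (+ (n ℕ.!))
prodTo-ι-suc zero    = sym ι-1
prodTo-ι-suc (suc n) = trans (cong (_* ι (+ suc n)) (prodTo-ι-suc n)) (trans (sym (ιℕ-* (n ℕ.!) (suc n))) (cong (λ z → ι (+ z)) (ℕP.*-comm (n ℕ.!) (suc n))))

prodTo-const : ∀ n c → prodTo n (λ _ → c) ≡ c ^ n
prodTo-const zero    c = refl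
prodTo-const (suc n) c = trans (cong (_* c) (prodTo-const n c)) (ℚP.*-comm (c ^ n) c)

-1^even : ∀ q → (- 1ℚ) ^ (q ℕ.* 2) ≡ 1ℚ
-1^even zero    = refl
-1^even (suc q) = trans (solve 1 (λ P → (:- con 1ℚ) :* ((:- con 1ℚ) :* P) := P) refl ((- 1ℚ) ^ (q ℕ.* 2))) (-1^even q)

odd-prime : ∀ {p} → Prime p → 3 ℕ.≤ p → ∃[ q ] p ∸ 1 ≡ q ℕ.* 2
odd-prime {p} p-prime 3≤p with p ℕ/.% 2 | ℕ/.m≡m%n+[m/n]*n p 2 | ℕ/.m%n<n p 2
... | zero | p≡[p/2]*2 | _ with prime⇒irreducible p-prime (divides (p ℕ/./ 2) p≡[p/2]*2)
...   | inj₁ ()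
...   | inj₂ refl = ⊥-elim (ℕP.<⇒≱ 3≤p ℕP.≤-refl)
odd-prime {p} _ _ | suc zero    | p≡1+[p/2]*2 | _               = p ℕ/./ 2 , cong (_∸ 1) p≡1+[p/2]*2
odd-prime {p} _ _ | suc (suc _) | _           | s≤s (s≤s ())

module _ (k : ℤ) (p′ q : ℕ) (p′≡2q : p′ ≡ q ℕ.* 2) where

  private
    p = suc p′
    x = k ℤ.* + p
    P = ι (+ p)
    F = prodTo p′ (λ t → ι (+ suc t))

    pow-p-1 : pow p 1 ≡ P
    pow-p-1 = cong (λ z → ι (+ z)) (ℕP.*-identityʳ p)

    t*t⁻¹ : ∀ t → ι (+ suc t) * invPow t 1 ≡ 1ℚ
    t*t⁻¹ t = trans (ℚP.*-comm _ (invPow t 1)) (trans (cong (λ z → invPow t 1 * ι (+ z)) (sym (ℕP.*-identityʳ (suc t)))) (invPow-*-pow t 1))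

    Q-factor : ℤ → ℕ → ℚ
    Q-factor l t = 1ℚ + (ι l * pow p 1) * invPow t 1

    factor-out : ∀ l t → ι (+ suc t) + ι l * P ≡ ι (+ suc t) * Q-factor l t
    factor-out l t = begin
      ι (+ suc t) + ι l * P                                      ≡⟨ cong (λ z → ι (+ suc t) + z) (sym (ℚP.*-identityʳ (ι l * P))) ⟩
      ι (+ suc t) + (ι l * P) * 1ℚ                               ≡⟨ cong (λ z → ι (+ suc t) + (ι l * P) * z) (sym (t*t⁻¹ t)) ⟩
      ι (+ suc t) + (ι l * P) * (ι (+ suc t) * invPow t 1)        ≡⟨ solve 4 (λ a b s i → s :+ (a :* b) :* (s :* i) := s :* (con 1ℚ :+ (a :* b) :* i)) refl (ι l) P (ι (+ suc t)) (invPow t 1) ⟩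
      ι (+ suc t) * (1ℚ + (ι l * P) * invPow t 1)                ≡⟨ cong (λ z → ι (+ suc t) * (1ℚ + (ι l * z) * invPow t 1)) (sym pow-p-1) ⟩
      ι (+ suc t) * Q-factor l t                                 ∎

    rp+t≡ : ∀ r t → ι (+ (r ℕ.* p ℕ.+ t)) ≡ ι (+ r) * P + ι (+ t)
    rp+t≡ r t = trans (ιℕ-+ (r ℕ.* p) t) (cong (_+ ι (+ t)) (ιℕ-* r p))

    x-[rp+t]≡ : ∀ r t → ι (x ℤ.- + (r ℕ.* p ℕ.+ t)) ≡ (ι k - ι (+ r)) * P - ι (+ t)
    x-[rp+t]≡ r t = begin
      ι (x ℤ.- + (r ℕ.* p ℕ.+ t))          ≡⟨ ι-- x _ ⟩
      ι x - ι (+ (r ℕ.* p ℕ.+ t))          ≡⟨ cong₂ _-_ (ι-* k (+ p)) (rp+t≡ r t) ⟩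
      ι k * P - (ι (+ r) * P + ι (+ t))    ≡⟨ solve 4 (λ a b c s → a :* c :- (b :* c :+ s) := (a :- b) :* c :- s) refl (ι k) (ι (+ r)) P (ι (+ t)) ⟩
      (ι k - ι (+ r)) * P - ι (+ t)        ∎

  prodTo-rising : ∀ r → prodTo p (λ u → ι (+ suc (r ℕ.* p ℕ.+ u))) ≡ (F * Q (+ r) p) * (ι (+ suc r) * P)
  prodTo-rising r = cong₂ _*_
    (trans (prodTo-cong p′ factor) (prodTo-* p′ (λ t → ι (+ suc t)) (Q-factor (+ r))))
    (trans (cong (λ z → ι (+ suc z)) (ℕP.+-comm (r ℕ.* p) p′)) (ιℕ-* (suc r) p))
    where
    factor : ∀ t → ι (+ suc (r ℕ.* p ℕ.+ t)) ≡ ι (+ suc t) * Q-factor (+ r) t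
    factor t = begin
      ι (+ suc (r ℕ.* p ℕ.+ t))     ≡⟨ cong (λ z → ι (+ z)) (sym (ℕP.+-suc (r ℕ.* p) t)) ⟩
      ι (+ (r ℕ.* p ℕ.+ suc t))     ≡⟨ rp+t≡ r (suc t) ⟩
      ι (+ r) * P + ι (+ suc t)     ≡⟨ ℚP.+-comm (ι (+ r) * P) _ ⟩
      ι (+ suc t) + ι (+ r) * P     ≡⟨ factor-out (+ r) t ⟩
      ι (+ suc t) * Q-factor (+ r) t ∎

  prodTo-falling : ∀ r → prodTo p (λ u → ι (x ℤ.- + (r ℕ.* p ℕ.+ u))) ≡ (ι (k ℤ.- + r) * P) * (F * Q (+ r ℤ.- k) p)
  prodTo-falling r = begin
    prodTo p f                                                       ≡⟨ prodTo-unfoldˡ p′ f ⟩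
    f 0 * prodTo p′ (f ∘ suc)                                        ≡⟨ cong₂ _*_ first (prodTo-cong p′ factor) ⟩
    (ι (k ℤ.- + r) * P) * prodTo p′ (λ t → (- 1ℚ) * (ι (+ suc t) * Q-factor (+ r ℤ.- k) t))
      ≡⟨ cong ((ι (k ℤ.- + r) * P) *_) (trans (prodTo-* p′ (λ _ → - 1ℚ) _) (cong₂ _*_ signs (prodTo-* p′ (λ t → ι (+ suc t)) (Q-factor (+ r ℤ.- k))))) ⟩
    (ι (k ℤ.- + r) * P) * (1ℚ * (F * Q (+ r ℤ.- k) p))                ≡⟨ cong ((ι (k ℤ.- + r) * P) *_) (ℚP.*-identityˡ _) ⟩
    (ι (k ℤ.- + r) * P) * (F * Q (+ r ℤ.- k) p)                       ∎
    where
    f = λ u → ι (x ℤ.- + (r ℕ.* p ℕ.+ u))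
    signs : prodTo p′ (λ _ → - 1ℚ) ≡ 1ℚ
    signs = trans (prodTo-const p′ (- 1ℚ)) (trans (cong ((- 1ℚ) ^_) p′≡2q) (-1^even q))
    first : f 0 ≡ ι (k ℤ.- + r) * P
    first = begin
      f 0                                ≡⟨ x-[rp+t]≡ r 0 ⟩
      (ι k - ι (+ r)) * P - ι (+ 0)      ≡⟨ cong (λ z → (ι k - ι (+ r)) * P - z) ι-0 ⟩
      (ι k - ι (+ r)) * P - 0ℚ           ≡⟨ solve 1 (λ a → a :- con 0ℚ := a) refl ((ι k - ι (+ r)) * P) ⟩
      (ι k - ι (+ r)) * P                ≡⟨ cong (_* P) (sym (ι-- k (+ r))) ⟩
      ι (k ℤ.- + r) * P                  ∎
    factor : ∀ t → f (suc t) ≡ (- 1ℚ) * (ι (+ suc t) * Q-factor (+ r ℤ.- k) t)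
    factor t = begin
      f (suc t)                                       ≡⟨ x-[rp+t]≡ r (suc t) ⟩
      (ι k - ι (+ r)) * P - ι (+ suc t)               ≡⟨ solve 4 (λ a b c s → (a :- b) :* c :- s := (:- con 1ℚ) :* (s :+ (b :- a) :* c)) refl (ι k) (ι (+ r)) P (ι (+ suc t)) ⟩
      (- 1ℚ) * (ι (+ suc t) + (ι (+ r) - ι k) * P)    ≡⟨ cong (λ z → (- 1ℚ) * (ι (+ suc t) + z * P)) (sym (ι-- (+ r) k)) ⟩
      (- 1ℚ) * (ι (+ suc t) + ι (+ r ℤ.- k) * P)      ≡⟨ cong ((- 1ℚ) *_) (factor-out (+ r ℤ.- k) t) ⟩
      (- 1ℚ) * (ι (+ suc t) * Q-factor (+ r ℤ.- k) t) ∎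

  -- Comparing binom(x, (r+1)p) with binom(x, rp): the p new factors of the numerator and of the
  -- denominator are each (up to sign) p′! · p times a product Q.
  binom-step : ∀ r → binom x (suc r ℕ.* p) * (Q (+ r) p * ι (+ suc r)) ≡ binom x (r ℕ.* p) * (ι (k ℤ.- + r) * Q (+ r ℤ.- k) p)
  binom-step r = *-ι-cancelʳ (p′ ℕ.! ℕ.* p) {{ℕP.m*n≢0 (p′ ℕ.!) p {{p′ ℕP.!≢0}}}} _ _ (begin
    B₁ * (Qr * ι (+ suc r)) * ι (+ (p′ ℕ.! ℕ.* p))           ≡⟨ cong (λ z → B₁ * (Qr * ι (+ suc r)) * z) F*P ⟩
    B₁ * (Qr * ι (+ suc r)) * (F * P)                        ≡⟨ solve 5 (λ B Q s F P → B :* (Q :* s) :* (F :* P) := B :* ((F :* Q) :* (s :* P))) refl B₁ Qr (ι (+ suc r)) F P ⟩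
    B₁ * ((F * Qr) * (ι (+ suc r) * P))                      ≡⟨ cong (B₁ *_) (sym (prodTo-rising r)) ⟩
    B₁ * prodTo p (λ u → ι (+ suc (r ℕ.* p ℕ.+ u)))          ≡⟨ cong (λ m → binom x m * prodTo p (λ u → ι (+ suc (r ℕ.* p ℕ.+ u)))) (ℕP.+-comm p (r ℕ.* p)) ⟩
    binom x (r ℕ.* p ℕ.+ p) * prodTo p (λ u → ι (+ suc (r ℕ.* p ℕ.+ u)))   ≡⟨ binom-+-*-prodTo x (r ℕ.* p) p ⟩
    B₀ * prodTo p (λ u → ι (x ℤ.- + (r ℕ.* p ℕ.+ u)))        ≡⟨ cong (B₀ *_) (prodTo-falling r) ⟩
    B₀ * ((ι (k ℤ.- + r) * P) * (F * Q′))                    ≡⟨ solve 5 (λ B a P F Q → B :* ((a :* P) :* (F :* Q)) := B :* (a :* Q) :* (F :* P)) refl B₀ (ι (k ℤ.- + r)) P F Q′ ⟩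
    B₀ * (ι (k ℤ.- + r) * Q′) * (F * P)                      ≡⟨ cong (λ z → B₀ * (ι (k ℤ.- + r) * Q′) * z) (sym F*P) ⟩
    B₀ * (ι (k ℤ.- + r) * Q′) * ι (+ (p′ ℕ.! ℕ.* p))         ∎)
    where
    B₁ = binom x (suc r ℕ.* p)
    B₀ = binom x (r ℕ.* p)
    Qr = Q (+ r) p
    Q′ = Q (+ r ℤ.- k) p
    F*P : ι (+ (p′ ℕ.! ℕ.* p)) ≡ F * P
    F*P = trans (ιℕ-* (p′ ℕ.!) p) (cong (_* P) (sym (prodTo-ι-suc p′)))

  binom-*-prodTo-Q : ∀ r → binom x (r ℕ.* p) * prodTo r (λ m → Q (+ m) p) ≡ binom k r * prodTo r (λ m → Q (+ m ℤ.- k) p)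
  binom-*-prodTo-Q zero    = refl
  binom-*-prodTo-Q (suc r) = *-ι-cancelʳ (suc r) _ _ (begin
    B₁ * (ΠQ * Qr) * ι (+ suc r)                   ≡⟨ solve 4 (λ B P Q s → B :* (P :* Q) :* s := (B :* (Q :* s)) :* P) refl B₁ ΠQ Qr (ι (+ suc r)) ⟩
    (B₁ * (Qr * ι (+ suc r))) * ΠQ                 ≡⟨ cong (_* ΠQ) (binom-step r) ⟩
    (B₀ * (ι (k ℤ.- + r) * Q′)) * ΠQ               ≡⟨ solve 4 (λ B a Q P → (B :* (a :* Q)) :* P := (a :* Q) :* (B :* P)) refl B₀ (ι (k ℤ.- + r)) Q′ ΠQ ⟩
    (ι (k ℤ.- + r) * Q′) * (B₀ * ΠQ)               ≡⟨ cong ((ι (k ℤ.- + r) * Q′) *_) (binom-*-prodTo-Q r) ⟩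
    (ι (k ℤ.- + r) * Q′) * (binom k r * ΠQ′)       ≡⟨ solve 4 (λ a Q b P → (a :* Q) :* (b :* P) := (b :* a) :* (P :* Q)) refl (ι (k ℤ.- + r)) Q′ (binom k r) ΠQ′ ⟩
    (binom k r * ι (k ℤ.- + r)) * (ΠQ′ * Q′)       ≡⟨ cong (_* (ΠQ′ * Q′)) (sym (binom-suc k r)) ⟩
    (binom k (suc r) * ι (+ suc r)) * (ΠQ′ * Q′)   ≡⟨ solve 3 (λ b s P → (b :* s) :* P := b :* P :* s) refl (binom k (suc r)) (ι (+ suc r)) (ΠQ′ * Q′) ⟩
    binom k (suc r) * (ΠQ′ * Q′) * ι (+ suc r)     ∎)
    where
    B₁ = binom x (suc r ℕ.* p)
    B₀ = binom x (r ℕ.* p)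
    ΠQ = prodTo r (λ m → Q (+ m) p)
    ΠQ′ = prodTo r (λ m → Q (+ m ℤ.- k) p)
    Qr = Q (+ r) p
    Q′ = Q (+ r ℤ.- k) p

theorem5 : (k : ℤ) (r : ℕ) → AsymptoticallyRepresentable (λ p → binom (k ℤ.* + p) (r ℕ.* p))
theorem5 k r = expansion⇒representable (expansion-quotient {a = λ p → binom (k ℤ.* + p) (r ℕ.* p)} numerator (expansion₁-prodTo r (λ m → Q (+ m)) (λ m → expansion₁-Q (+ m))) 3 identity)
  where
  numerator : Expansion (λ p → binom k r * prodTo r (λ m → Q (+ m ℤ.- k) p))
  numerator = expansion-* (expansion-const (binom k r)) (proj₁ (expansion₁-prodTo r (λ m → Q (+ m ℤ.- k)) (λ m → expansion₁-Q (+ m ℤ.- k))))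
  identity : ∀ p → Prime p → 3 ℕ.≤ p → binom (k ℤ.* + p) (r ℕ.* p) * prodTo r (λ m → Q (+ m) p) ≡ binom k r * prodTo r (λ m → Q (+ m ℤ.- k) p)
  identity (suc p′) p-prime 3≤p with odd-prime p-prime 3≤p
  ... | q , p′≡2q = binom-*-prodTo-Q k p′ q p′≡2q r
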